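{- In the setting described in the context, the following bounds hold: (a) $e(\mathcal I)=0$; (b) $e(\mathcal I,\mathcal M)\le im$; (c) $e(\mathcal M)\le m^2$; (d) $e(\mathcal M,\mathcal T_1)\le 4mt_1$; (e) $e(\mathcal I,\mathcal T_1)\le 2it_1$; (f) $e(\mathcal T_1)\le 7\binom{t_1}{2}+3t_1$; (g) $e(\mathcal I,\mathcal T_2)\le 2it_2$; (h) $e(\mathcal T_2)\le 8\binom{t_2}{2}+3t_2$; (i) $e(\mathcal T_3)+e(\mathcal T_3,\mathcal T_4)\le 8\binom{t_3}{2}+8t_3t_4+3t_3$.
   Context: Setting: Let $n,k\ge0$ be integers and let $G$ be an $n$-vertex graph which is edge-maximal subject to not containing $k+1$ pairwise vertex-disjoint triangles. Let $\mathcal T$ be a set of $k$ vertex-disjoint triangles in $G$ and $\mathcal M$ a maximum matching in $G-V(\mathcal T)$, where $\mathcal T$ is chosen among all sets of $k$ vertex-disjoint triangles of $G$ so as to maximise $|\mathcal M|$. Let $\mathcal I$ be the set of vertices of $G$ covered neither by $\mathcal T$ nor by $\mathcal M$. An edge $uv$ sees a vertex $x$ of a triangle $xyz$ if $uvx$ is a triangle of $G$, and sees the triangle $xyz$ if it sees at least one of $x,y,z$. A vertex $u$ sees the edge $xy$ of the triangle $xyz$ (and then sees the triangle) if $uxy$ is a triangle of $G$. Let $\mathcal T_1$ be the set of triangles of $\mathcal T$ seen by at least two edges of $\mathcal M$; let $\mathcal T_2$ be the set of triangles of $\mathcal T\setminus\mathcal T_1$ seen either by an edge of $\mathcal M$ and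 at least one vertex of $\mathcal I$, or by two vertices of $\mathcal I$. Start with $D=\mathcal T\setminus(\mathcal T_1\cup\mathcal T_2)$ and $S=\emptyset$; as long as some triangle of $D$ sends at most $8(|D|-1)$ edges to (the vertices of) the other triangles of $D$, move such a triangle from $D$ to $S$; when no such triangle exists set $\mathcal T_3=S$, $\mathcal T_4=D$ (any outcome of this procedure is allowed). Put $m=|\mathcal M|$, $i=|\mathcal I|$, $t_j=|\mathcal T_j|$. For a family $\mathcal X$ of triangles or edges (or the set $\mathcal I$), $e(\mathcal X)$ is the number of edges of $G$ induced by the vertices covered by $\mathcal X$, and $e(\mathcal X,\mathcal Y)$ is the number of edges of $G$ with one endpoint covered by $\mathcal X$ and the other covered by $\mathcal Y$. -}

module Defs where

open import Data.Nat using (ℕ; zero; suc; _+_; _*_; _∸_; _≤_; _<_; _≤ᵇ_; _<ᵇ_)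
open import Data.Bool using (Bool; true; false; _∧_; _∨_; not; if_then_else_)
open import Data.Fin using (Fin; zero; suc; toℕ; _≟_)
open import Data.Product using (Σ; _×_)
open import Relation.Nullary using (¬_)
open import Relation.Nullary.Decidable using (⌊_⌋)
open import Relation.Binary.PropositionalEquality using (_≡_; _≢_)

sumFin : (k : ℕ) → (Fin k → ℕ) → ℕ
sumFin zero    f = 0
sumFin (suc k) f = f zero + sumFin k (λ i → f (suc i))

countFin : (k : ℕ) → (Fin k → Bool) → ℕ
countFin k p = sumFin k (λ i → if p i then 1 else 0)

anyFin : (k : ℕ) → (Fin k → Bool) → Bool
anyFin zero    p = false
anyFin (suc k) p = p zero ∨ anyFin k (λ i → p (suc i))

f0 : Fin 3
f0 = zero
f1 : Fin 3
f1 = suc zero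
f2 : Fin 3
f2 = suc (suc zero)

e0 : Fin 2
e0 = zero
e1 : Fin 2
e1 = suc zero

Adj : ℕ → Set
Adj n = Fin n → Fin n → Bool

record Graph (n : ℕ) : Set where
  field
    adj    : Adj n
    sym    : ∀ u v → adj u v ≡ adj v u
    irrefl : ∀ u → adj u u ≡ false
open Graph public

addEdge : {n : ℕ} → Adj n → Fin n → Fin n → Adj n
addEdge a u v x y = a x y ∨ (⌊ x ≟ u ⌋ ∧ ⌊ y ≟ v ⌋) ∨ (⌊ x ≟ v ⌋ ∧ ⌊ y ≟ u ⌋)

IsTriangle : {n : ℕ} → Adj n → (Fin 3 → Fin n) → Set
IsTriangle a t = (a (t f0) (t f1) ≡ true) × (a (t f1) (t f2) ≡ true) × (a (t f0) (t f2) ≡ true)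

IsDisjTriangles : {n k : ℕ} → Adj n → (Fin k → Fin 3 → Fin n) → Set
IsDisjTriangles {n} {k} a T =
  (∀ (j j′ : Fin k) (c c′ : Fin 3) → T j c ≡ T j′ c′ → (j ≡ j′) × (c ≡ c′))
  × (∀ j → IsTriangle a (T j))

HasDisjTriangles : {n : ℕ} → Adj n → ℕ → Set
HasDisjTriangles {n} a k = Σ (Fin k → Fin 3 → Fin n) (IsDisjTriangles a)

EdgeMaximal : {n : ℕ} → Graph n → ℕ → Set
EdgeMaximal {n} G k =
  (¬ HasDisjTriangles (adj G) (suc k))
  × (∀ (u v : Fin n) → u ≢ v → adj G u v ≡ false → HasDisjTriangles (addEdge (adj G) u v) (suc k))

-- M (m edges, each a map Fin 2 → Fin n) is a matching of G - V(T)
IsMatchingAvoiding : {n k m : ℕ} → Adj n → (Fin k → Fin 3 → Fin n) → (Fin m → Fin 2 → Fin n) → Set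
IsMatchingAvoiding {n} {k} {m} a T M =
  (∀ (l l′ : Fin m) (c c′ : Fin 2) → M l c ≡ M l′ c′ → (l ≡ l′) × (c ≡ c′))
  × (∀ l → a (M l e0) (M l e1) ≡ true)
  × (∀ (l : Fin m) (c : Fin 2) (j : Fin k) (d : Fin 3) → M l c ≢ T j d)

VSet : ℕ → Set
VSet n = Fin n → Bool

trisV : {n k : ℕ} → (Fin k → Fin 3 → Fin n) → (Fin k → Bool) → VSet n
trisV {n} {k} T P v = anyFin k (λ j → P j ∧ anyFin 3 (λ c → ⌊ T j c ≟ v ⌋))

matchV : {n m : ℕ} → (Fin m → Fin 2 → Fin n) → VSet n
matchV {n} {m} M v = anyFin m (λ l → anyFin 2 (λ c → ⌊ M l c ≟ v ⌋))

eIn : {n : ℕ} → Adj n → VSet n → ℕ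
eIn {n} a X = sumFin n (λ u → countFin n (λ v → (toℕ u <ᵇ toℕ v) ∧ X u ∧ X v ∧ a u v))

eBetween : {n : ℕ} → Adj n → VSet n → VSet n → ℕ
eBetween {n} a X Y = sumFin n (λ u → countFin n (λ v →
  (toℕ u <ᵇ toℕ v) ∧ a u v ∧ ((X u ∧ Y v) ∨ (Y u ∧ X v))))

edgeSeesVertex : {n : ℕ} → Adj n → Fin n → Fin n → Fin n → Bool
edgeSeesVertex a p q x = a p q ∧ a p x ∧ a q x

edgeSeesTri : {n : ℕ} → Adj n → Fin n → Fin n → (Fin 3 → Fin n) → Bool
edgeSeesTri a p q t = anyFin 3 (λ c → edgeSeesVertex a p q (t c))

vertexSeesEdge : {n : ℕ} → Adj n → Fin n → Fin n → Fin n → Bool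
vertexSeesEdge a u x y = a u x ∧ a u y ∧ a x y

vertexSeesTri : {n : ℕ} → Adj n → Fin n → (Fin 3 → Fin n) → Bool
vertexSeesTri a u t = vertexSeesEdge a u (t f0) (t f1) ∨ vertexSeesEdge a u (t f1) (t f2)
                      ∨ vertexSeesEdge a u (t f0) (t f2)

module Setting {n k m : ℕ} (G : Graph n) (T : Fin k → Fin 3 → Fin n) (M : Fin m → Fin 2 → Fin n) where

  Iset : VSet n
  Iset v = not (trisV T (λ _ → true) v) ∧ not (matchV M v)

  nEdgesSee : Fin k → ℕ
  nEdgesSee j = countFin m (λ l → edgeSeesTri (adj G) (M l e0) (M l e1) (T j))

  nIsee : Fin k → ℕ
  nIsee j = countFin n (λ u → Iset u ∧ vertexSeesTri (adj G) u (T j))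

  T₁ : Fin k → Bool
  T₁ j = 2 ≤ᵇ nEdgesSee j

  T₂ : Fin k → Bool
  T₂ j = not (T₁ j) ∧ (((1 ≤ᵇ nEdgesSee j) ∧ (1 ≤ᵇ nIsee j)) ∨ (2 ≤ᵇ nIsee j))

  D₀ : Fin k → Bool
  D₀ j = not (T₁ j ∨ T₂ j)

  sends : (Fin k → Bool) → Fin k → ℕ
  sends D j = eBetween (adj G) (trisV T (λ j′ → ⌊ j′ ≟ j ⌋)) (trisV T (λ j′ → D j′ ∧ not ⌊ j′ ≟ j ⌋))

  remove : (Fin k → Bool) → Fin k → (Fin k → Bool)
  remove D j j′ = D j′ ∧ not ⌊ j′ ≟ j ⌋

  insert : (Fin k → Bool) → Fin k → (Fin k → Bool)
  insert S j j′ = S j′ ∨ ⌊ j′ ≟ j ⌋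

  -- Peel D S D′ S′ : starting from (D , S) the procedure may terminate in (D′ , S′)
  data Peel : (D S D′ S′ : Fin k → Bool) → Set where
    stop : ∀ {D S} →
           (∀ j → D j ≡ true → 8 * (countFin k D ∸ 1) < sends D j) →
           Peel D S D S
    move : ∀ {D S D′ S′} (j : Fin k) → D j ≡ true →
           sends D j ≤ 8 * (countFin k D ∸ 1) →
           Peel (remove D j) (insert S j) D′ S′ →
           Peel D S D′ S′

module Submission where

-- Every count in the statement is a sum, over pairs of blocks (vertices of ℐ, edges of ℳ,
-- triangles of 𝒯), of the number of edges joining the two blocks, so it suffices to bound these
-- local counts. Each local bound is an exchange argument: a configuration exceeding it lets one
-- replace one or two triangles of 𝒯 by triangles through an edge of ℳ or a vertex of ℐ, and then
-- either add a (k+1)-st disjoint triangle, contradicting the choice of G, or add an edge to ℳ,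
-- contradicting the maximality of |ℳ|. For (i), moving a triangle from D to S during the peeling
-- raises e(S) + e(S , D) by at most 3 + 8(|D| − 1), and these increments telescope to the bound.

open import Defs hiding (sym)
open import Data.Nat using (ℕ; zero; suc; _+_; _*_; _∸_; _≤_; z≤n; s≤s; s≤s⁻¹; _≤ᵇ_; _<ᵇ_)
open import Data.Nat.Properties
  using ( ≤-refl; ≤-trans; ≤-reflexive; _≤?_; ≤ᵇ⇒≤; <ᵇ⇒<; <⇒≯; <⇒≱; ≰⇒>; n≤0⇒n≡0; 1+n≰n; m≤m+n
        ; +-mono-≤; +-monoˡ-≤; +-monoʳ-≤; +-mono-<; +-cancelʳ-≤; +-identityʳ; +-suc
        ; *-zeroʳ; *-identityʳ; *-distribˡ-+; *-distribʳ-+; module ≤-Reasoning )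
open import Data.Nat.Combinatorics using (_C_; nCk+nC[k+1]≡[n+1]C[k+1]; nC1≡n)
open import Data.Nat.Tactic.RingSolver using (solve-∀)
open import Data.Fin using (Fin; zero; suc; toℕ; _≟_)
open import Data.Bool using (Bool; true; false; _∧_; _∨_; not; if_then_else_; T)
open import Data.Bool.Properties using (T-∧; ¬-not; ∧-zeroʳ; ∧-identityʳ; ∨-zeroʳ; ∨-identityʳ)
open import Data.Bool.Solver using (module ∨-∧-Solver)
open import Data.Product using (_×_; _,_; ∃; ∃₂; proj₁; proj₂)
open import Data.Sum using (_⊎_; inj₁; inj₂)
open import Data.Empty using (⊥; ⊥-elim)
open import Data.Unit using (tt)
open import Function.Bundles using (Equivalence)
open import Relation.Nullary using (yes; no; contradiction)
open import Relation.Nullary.Decidable using (⌊_⌋; ⌊⌋-map′)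
open import Relation.Binary.PropositionalEquality
  using (_≡_; _≢_; refl; sym; trans; cong; cong₂; subst; subst₂; cong-app; ≢-sym; module ≡-Reasoning)

Formula : ℕ → Set
Formula zero    = Bool
Formula (suc n) = Bool → Formula n

tautology? : ∀ n → Formula n → Bool
tautology? zero    b = b
tautology? (suc n) φ = tautology? n (φ false) ∧ tautology? n (φ true)

Valid : ∀ n → Formula n → Set
Valid zero    b = T b
Valid (suc n) φ = ∀ b → Valid n (φ b)

tautology : ∀ n {φ : Formula n} → T (tautology? n φ) → Valid n φ
tautology zero    t       = t
tautology (suc n) t false = tautology n (proj₁ (Equivalence.to T-∧ t))
tautology (suc n) t true  = tautology n (proj₂ (Equivalence.to T-∧ t))

resolve : ∀ {p q} → p ≡ false → T (p ∨ q) → T q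
resolve refl t = t

∧-elimˡ : ∀ {a b} → a ∧ b ≡ true → a ≡ true
∧-elimˡ {true} _ = refl

∧-elimʳ : ∀ {a b} → a ∧ b ≡ true → b ≡ true
∧-elimʳ {true} e = e

∧-intro : ∀ {a b} → a ≡ true → b ≡ true → a ∧ b ≡ true
∧-intro refl refl = refl

not≡true⇒≡false : ∀ {b} → not b ≡ true → b ≡ false
not≡true⇒≡false {false} _ = refl

∨-elim : ∀ {a b} → a ∨ b ≡ true → (a ≡ true) ⊎ (b ≡ true)
∨-elim {true}  _ = inj₁ refl
∨-elim {false} e = inj₂ e

≟-refl : ∀ {n} (i : Fin n) → ⌊ i ≟ i ⌋ ≡ true
≟-refl i with i ≟ i
... | yes _  = refl
... | no i≢i = ⊥-elim (i≢i refl)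

≟-≢ : ∀ {n} {i j : Fin n} → i ≢ j → ⌊ i ≟ j ⌋ ≡ false
≟-≢ {i = i} {j} i≢j with i ≟ j
... | yes i≡j = ⊥-elim (i≢j i≡j)
... | no _    = refl

≟-≡ : ∀ {n} {i j : Fin n} → ⌊ i ≟ j ⌋ ≡ true → i ≡ j
≟-≡ {i = i} {j} e with i ≟ j
... | yes i≡j = i≡j

≡⇒≟ : ∀ {n} {i j : Fin n} → i ≡ j → ⌊ i ≟ j ⌋ ≡ true
≡⇒≟ {i = i} refl = ≟-refl i

≟-suc : ∀ {n} (i j : Fin n) → ⌊ Fin.suc i ≟ suc j ⌋ ≡ ⌊ i ≟ j ⌋
≟-suc i j = ⌊⌋-map′ _ _ (i ≟ j)

mask : Bool → ℕ → ℕ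
mask b x = if b then x else 0

-- The Iverson bracket; countFin k p unfolds to sumFin k (λ i → ⟦ p i ⟧).
⟦_⟧ : Bool → ℕ
⟦ b ⟧ = mask b 1

mask≤ : ∀ b x → mask b x ≤ x
mask≤ true  x = ≤-refl
mask≤ false x = z≤n

mask-mono : ∀ b {x y} → x ≤ y → mask b x ≤ mask b y
mask-mono true  x≤y = x≤y
mask-mono false _   = z≤n

mask-∧ : ∀ a b x → mask (a ∧ b) x ≡ mask a (mask b x)
mask-∧ true  b x = refl
mask-∧ false b x = refl

sum-cong : ∀ k {f g : Fin k → ℕ} → (∀ i → f i ≡ g i) → sumFin k f ≡ sumFin k g
sum-cong zero    f≗g = refl
sum-cong (suc k) f≗g = cong₂ _+_ (f≗g zero) (sum-cong k (λ i → f≗g (suc i)))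

sum-mono : ∀ k {f g : Fin k → ℕ} → (∀ i → f i ≤ g i) → sumFin k f ≤ sumFin k g
sum-mono zero    f≤g = z≤n
sum-mono (suc k) f≤g = +-mono-≤ (f≤g zero) (sum-mono k (λ i → f≤g (suc i)))

sum-const : ∀ k c → sumFin k (λ _ → c) ≡ k * c
sum-const zero    c = refl
sum-const (suc k) c = cong (c +_) (sum-const k c)

sum-zero : ∀ k → sumFin k (λ _ → 0) ≡ 0
sum-zero k = trans (sum-const k 0) (*-zeroʳ k)

sum-+ : ∀ k (f g : Fin k → ℕ) → sumFin k (λ i → f i + g i) ≡ sumFin k f + sumFin k g
sum-+ zero    f g = refl
sum-+ (suc k) f g = trans (cong (f zero + g zero +_) (sum-+ k (λ i → f (suc i)) (λ i → g (suc i))))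
                          (+-+-comm (f zero) (g zero) _ _)
  where +-+-comm : ∀ a b c d → a + b + (c + d) ≡ (a + c) + (b + d)
        +-+-comm = solve-∀

sum-swap : ∀ k l (f : Fin k → Fin l → ℕ) →
  sumFin k (λ i → sumFin l (f i)) ≡ sumFin l (λ j → sumFin k (λ i → f i j))
sum-swap zero    l f = sym (sum-zero l)
sum-swap (suc k) l f = trans (cong (sumFin l (f zero) +_) (sum-swap k l (λ i → f (suc i))))
                             (sym (sum-+ l (f zero) _))

sum-mask : ∀ k b (f : Fin k → ℕ) → sumFin k (λ i → mask b (f i)) ≡ mask b (sumFin k f)
sum-mask k true  f = refl
sum-mask k false f = sum-zero k

sum-*ˡ : ∀ k c (f : Fin k → ℕ) → sumFin k (λ i → c * f i) ≡ c * sumFin k f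
sum-*ˡ zero    c f = sym (*-zeroʳ c)
sum-*ˡ (suc k) c f = trans (cong (c * f zero +_) (sum-*ˡ k c (λ i → f (suc i))))
                           (sym (*-distribˡ-+ c (f zero) _))

sum-mask-const : ∀ k (p : Fin k → Bool) c → sumFin k (λ i → mask (p i) c) ≡ countFin k p * c
sum-mask-const zero    p c = refl
sum-mask-const (suc k) p c with p zero
... | true  = cong (c +_) (sum-mask-const k (λ i → p (suc i)) c)
... | false = sum-mask-const k (λ i → p (suc i)) c

sum-mask≤count* : ∀ k (p : Fin k → Bool) (f : Fin k → ℕ) c → (∀ i → p i ≡ true → f i ≤ c) →
  sumFin k (λ i → mask (p i) (f i)) ≤ countFin k p * c
sum-mask≤count* k p f c f≤c = ≤-trans (sum-mono k (λ i → bound i (p i) refl)) (≤-reflexive (sum-mask-const k p c))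
  where
  bound : ∀ i b → p i ≡ b → mask b (f i) ≤ mask b c
  bound i false _  = z≤n
  bound i true  pi = f≤c i pi

sum-extract : ∀ k (f : Fin k → ℕ) (j : Fin k) →
  sumFin k f ≡ f j + sumFin k (λ i → mask (not ⌊ i ≟ j ⌋) (f i))
sum-extract (suc k) f zero    = refl
sum-extract (suc k) f (suc j) = begin
  f zero + sumFin k (λ i → f (suc i))
    ≡⟨ cong (f zero +_) (sum-extract k (λ i → f (suc i)) j) ⟩
  f zero + (f (suc j) + sumFin k (λ i → mask (not ⌊ i ≟ j ⌋) (f (suc i))))
    ≡⟨ +-swap (f zero) (f (suc j)) _ ⟩
  f (suc j) + (f zero + sumFin k (λ i → mask (not ⌊ i ≟ j ⌋) (f (suc i))))
    ≡⟨ cong (λ s → f (suc j) + (f zero + s))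
            (sum-cong k (λ i → cong (λ b → mask (not b) (f (suc i))) (sym (≟-suc i j)))) ⟩
  f (suc j) + (f zero + sumFin k (λ i → mask (not ⌊ suc i ≟ suc j ⌋) (f (suc i))))
    ∎
  where
  open ≡-Reasoning
  +-swap : ∀ a b c → a + (b + c) ≡ b + (a + c)
  +-swap = solve-∀

count-extract : ∀ k (p : Fin k → Bool) (j : Fin k) → p j ≡ true →
  countFin k p ≡ suc (sumFin k (λ i → mask (not ⌊ i ≟ j ⌋) ⟦ p i ⟧))
count-extract k p j pj = trans (sum-extract k (λ i → ⟦ p i ⟧) j) (cong (λ b → ⟦ b ⟧ + others) pj)
  where others = sumFin k (λ i → mask (not ⌊ i ≟ j ⌋) ⟦ p i ⟧)

sum-delta : ∀ n (w : Fin n) (h : Fin n → ℕ) → sumFin n (λ v → mask ⌊ w ≟ v ⌋ (h v)) ≡ h w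
sum-delta n w h = begin
  sumFin n (λ v → mask ⌊ w ≟ v ⌋ (h v))
    ≡⟨ sum-extract n _ w ⟩
  mask ⌊ w ≟ w ⌋ (h w) + sumFin n (λ v → mask (not ⌊ v ≟ w ⌋) (mask ⌊ w ≟ v ⌋ (h v)))
    ≡⟨ cong₂ _+_ (cong (λ b → mask b (h w)) (≟-refl w)) (trans (sum-cong n off-diagonal) (sum-zero n)) ⟩
  h w + 0
    ≡⟨ +-identityʳ (h w) ⟩
  h w
    ∎
  where
  open ≡-Reasoning
  off-diagonal : ∀ v → mask (not ⌊ v ≟ w ⌋) (mask ⌊ w ≟ v ⌋ (h v)) ≡ 0
  off-diagonal v with v ≟ w
  ... | yes refl = refl
  ... | no v≢w   rewrite ≟-≢ (λ w≡v → v≢w (sym w≡v)) = refl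

sum-positive : ∀ k (f : Fin k → ℕ) → 1 ≤ sumFin k f → ∃ λ i → 1 ≤ f i
sum-positive (suc k) f pos with f zero in eq
... | suc _ = zero , subst (1 ≤_) (sym eq) (s≤s z≤n)
... | zero with sum-positive k (λ i → f (suc i)) pos
...   | i , fi = suc i , fi

⟦⟧-positive : ∀ b → 1 ≤ ⟦ b ⟧ → b ≡ true
⟦⟧-positive true _ = refl

count-witness : ∀ k (p : Fin k → Bool) → 1 ≤ countFin k p → ∃ λ i → p i ≡ true
count-witness k p pos with sum-positive k _ pos
... | i , pi = i , ⟦⟧-positive (p i) pi

count≥2-witness≢ : ∀ k (p : Fin k → Bool) → 2 ≤ countFin k p → ∀ j → ∃ λ i → i ≢ j × p i ≡ true
count≥2-witness≢ k p two j with p j in pj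
... | false with count-witness k p (≤-trans (s≤s z≤n) two)
...   | i , pi = i , (λ { refl → contradiction (trans (sym pi) pj) λ () }) , pi
count≥2-witness≢ k p two j | true with sum-positive k _ (s≤s⁻¹ (subst (2 ≤_) (count-extract k p j pj) two))
...   | i , pos = i , i≢j , ⟦⟧-positive (p i) (≤-trans pos (mask≤ (not ⌊ i ≟ j ⌋) _))
  where
  i≢j : i ≢ j
  i≢j refl = contradiction (subst (1 ≤_) (cong (λ b → mask (not b) _) (≟-refl i)) pos) λ ()

anyFin-witness : ∀ k (p : Fin k → Bool) → anyFin k p ≡ true → ∃ λ j → p j ≡ true
anyFin-witness (suc k) p any with p zero in p0
... | true  = zero , p0
... | false with anyFin-witness k (λ i → p (suc i)) any
...   | j , pj = suc j , pj

anyFin-false : ∀ k (p : Fin k → Bool) → anyFin k p ≡ false → ∀ j → p j ≡ false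
anyFin-false (suc k) p none zero    with p zero
... | false = refl
anyFin-false (suc k) p none (suc j) with p zero
... | false = anyFin-false k (λ i → p (suc i)) none j

anyFin-const-false : ∀ k → anyFin k (λ _ → false) ≡ false
anyFin-const-false zero    = refl
anyFin-const-false (suc k) = anyFin-const-false k

anyFin-cong : ∀ k {p q : Fin k → Bool} → (∀ j → p j ≡ q j) → anyFin k p ≡ anyFin k q
anyFin-cong zero    p≗q = refl
anyFin-cong (suc k) p≗q = cong₂ _∨_ (p≗q zero) (anyFin-cong k (λ j → p≗q (suc j)))

anyFin-∨ : ∀ k (p q r : Fin k → Bool) →
  anyFin k (λ j → (p j ∨ q j) ∧ r j) ≡ anyFin k (λ j → p j ∧ r j) ∨ anyFin k (λ j → q j ∧ r j)
anyFin-∨ zero    p q r = refl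
anyFin-∨ (suc k) p q r =
  trans (cong ((p zero ∨ q zero) ∧ r zero ∨_) (anyFin-∨ k (λ j → p (suc j)) (λ j → q (suc j)) (λ j → r (suc j))))
        (distrib (p zero) (q zero) (r zero) _ _)
  where
  open ∨-∧-Solver
  distrib : ∀ p q r x y → (p ∨ q) ∧ r ∨ (x ∨ y) ≡ (p ∧ r ∨ x) ∨ (q ∧ r ∨ y)
  distrib = solve 5 (λ p q r x y → (p :+ q) :* r :+ (x :+ y) := (p :* r :+ x) :+ (q :* r :+ y)) refl

mask-anyFin≤ : ∀ k (p : Fin k → Bool) x → mask (anyFin k p) x ≤ sumFin k (λ j → mask (p j) x)
mask-anyFin≤ zero    p x = z≤n
mask-anyFin≤ (suc k) p x with p zero
... | true  = m≤m+n x _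
... | false = mask-anyFin≤ k (λ i → p (suc i)) x

sum² : ∀ n → (Fin n → Fin n → ℕ) → ℕ
sum² n f = sumFin n (λ u → sumFin n (f u))

sum²-mono : ∀ n {f g : Fin n → Fin n → ℕ} → (∀ u v → f u v ≤ g u v) → sum² n f ≤ sum² n g
sum²-mono n f≤g = sum-mono n (λ u → sum-mono n (f≤g u))

sum²-zero : ∀ n → sum² n (λ _ _ → 0) ≡ 0
sum²-zero n = trans (sum-cong n (λ _ → sum-zero n)) (sum-zero n)

sum²-+ : ∀ n (f g : Fin n → Fin n → ℕ) → sum² n (λ u v → f u v + g u v) ≡ sum² n f + sum² n g
sum²-+ n f g = trans (sum-cong n (λ u → sum-+ n (f u) (g u))) (sum-+ n _ _)

sum²-transpose-+ : ∀ n (f g : Fin n → Fin n → ℕ) → sum² n f + sum² n g ≡ sum² n (λ u v → f u v + g v u)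
sum²-transpose-+ n f g = trans (cong (sum² n f +_) (sum-swap n n g)) (sym (sum²-+ n f (λ u v → g v u)))

_≺_ : ∀ {n} → Fin n → Fin n → Bool
u ≺ v = toℕ u <ᵇ toℕ v

≺-asym : ∀ {n} (u v : Fin n) → (u ≺ v) ∧ (v ≺ u) ≡ false
≺-asym u v with u ≺ v in u≺v | v ≺ u in v≺u
... | false | _     = refl
... | true  | false = refl
... | true  | true  = contradiction (<ᵇ⇒< (toℕ u) (toℕ v) (subst T (sym u≺v) tt))
                                    (<⇒≯ (<ᵇ⇒< (toℕ v) (toℕ u) (subst T (sym v≺u) tt)))

arcs : ∀ {n} → Adj n → VSet n → VSet n → ℕ
arcs {n} a X Y = sumFin n (λ u → mask (X u) (sumFin n (λ v → mask (Y v) ⟦ a u v ⟧)))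

sum²-mask≡arcs : ∀ {n} (a : Adj n) X Y → sum² n (λ u v → mask (X u) (mask (Y v) ⟦ a u v ⟧)) ≡ arcs a X Y
sum²-mask≡arcs {n} a X Y = sum-cong n (λ u → sum-mask n (X u) _)

module _ {n} (G : Graph n) where

  private
    a = adj G

    -- An edge uv with u ≺ v is counted once as (u , v); the reverse arc (v , u) is never ≺.
    merge : ∀ u v x y → ⟦ u ≺ v ∧ x ∧ y ∧ a u v ⟧ + ⟦ v ≺ u ∧ y ∧ x ∧ a v u ⟧ ≤ mask x (mask y ⟦ a u v ⟧)
    merge u v x y rewrite Graph.sym G v u =
      ≤ᵇ⇒≤ _ _ (resolve (≺-asym u v) (table (u ≺ v) (v ≺ u) x y (a u v)))
      where
      table : Valid 5 λ l l′ x y e → (l ∧ l′) ∨ (⟦ l ∧ x ∧ y ∧ e ⟧ + ⟦ l′ ∧ y ∧ x ∧ e ⟧ ≤ᵇ mask x (mask y ⟦ e ⟧))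
      table = tautology 5 _

  eBetween≤arcs : ∀ X Y → eBetween a X Y ≤ arcs a X Y
  eBetween≤arcs X Y = begin
    eBetween a X Y                                       ≤⟨ sum²-mono n split ⟩
    sum² n (λ u v → XY u v + YX u v)                       ≡⟨ sum²-+ n XY YX ⟩
    sum² n XY + sum² n YX                                  ≡⟨ sum²-transpose-+ n XY YX ⟩
    sum² n (λ u v → XY u v + YX v u)                       ≤⟨ sum²-mono n (λ u v → merge u v (X u) (Y v)) ⟩
    sum² n (λ u v → mask (X u) (mask (Y v) ⟦ a u v ⟧))   ≡⟨ sum²-mask≡arcs a X Y ⟩
    arcs a X Y                                           ∎
    where
    open ≤-Reasoning
    XY YX : Fin n → Fin n → ℕ
    XY u v = ⟦ u ≺ v ∧ X u ∧ Y v ∧ a u v ⟧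
    YX u v = ⟦ u ≺ v ∧ Y u ∧ X v ∧ a u v ⟧
    split : ∀ u v → ⟦ u ≺ v ∧ a u v ∧ ((X u ∧ Y v) ∨ (Y u ∧ X v)) ⟧ ≤ XY u v + YX u v
    split u v = ≤ᵇ⇒≤ _ _ (table (u ≺ v) (a u v) (X u) (Y v) (Y u) (X v))
      where
      table : Valid 6 λ l e x y y′ x′ → ⟦ l ∧ e ∧ ((x ∧ y) ∨ (y′ ∧ x′)) ⟧ ≤ᵇ ⟦ l ∧ x ∧ y ∧ e ⟧ + ⟦ l ∧ y′ ∧ x′ ∧ e ⟧
      table = tautology 6 _

  eIn+eIn≤arcs : ∀ X → eIn a X + eIn a X ≤ arcs a X X
  eIn+eIn≤arcs X = begin
    sum² n inX + sum² n inX                                  ≡⟨ sum²-transpose-+ n inX inX ⟩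
    sum² n (λ u v → inX u v + inX v u)                       ≤⟨ sum²-mono n (λ u v → merge u v (X u) (X v)) ⟩
    sum² n (λ u v → mask (X u) (mask (X v) ⟦ a u v ⟧))   ≡⟨ sum²-mask≡arcs a X X ⟩
    arcs a X X                                           ∎
    where
    open ≤-Reasoning
    inX : Fin n → Fin n → ℕ
    inX u v = ⟦ u ≺ v ∧ X u ∧ X v ∧ a u v ⟧

-- trisV T P and matchV M are coveredBy T P and coveredBy M (λ _ → true), definitionally.
coveredBy : ∀ {n k r} → (Fin k → Fin r → Fin n) → (Fin k → Bool) → VSet n
coveredBy {n} {k} {r} g P v = anyFin k (λ j → P j ∧ anyFin r (λ c → ⌊ g j c ≟ v ⌋))

blockArcs : ∀ {n r r′} → Adj n → (Fin r → Fin n) → (Fin r′ → Fin n) → ℕ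
blockArcs {r = r} {r′} a s t = sumFin r (λ c → sumFin r′ (λ c′ → ⟦ a (s c) (t c′) ⟧))

sum-coveredBy≤ : ∀ {n k r} (g : Fin k → Fin r → Fin n) (P : Fin k → Bool) (h : Fin n → ℕ) →
  sumFin n (λ v → mask (coveredBy g P v) (h v)) ≤ sumFin k (λ j → mask (P j) (sumFin r (λ c → h (g j c))))
sum-coveredBy≤ {n} {k} {r} g P h = begin
  sumFin n (λ v → mask (coveredBy g P v) (h v))
    ≤⟨ sum-mono n (λ v → mask-anyFin≤ k _ (h v)) ⟩
  sumFin n (λ v → sumFin k (λ j → mask (P j ∧ anyFin r (λ c → ⌊ g j c ≟ v ⌋)) (h v)))
    ≤⟨ sum-mono n (λ v → sum-mono k (λ j → by-block v j)) ⟩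
  sumFin n (λ v → sumFin k (λ j → mask (P j) (sumFin r (λ c → mask ⌊ g j c ≟ v ⌋ (h v)))))
    ≡⟨ sum-swap n k _ ⟩
  sumFin k (λ j → sumFin n (λ v → mask (P j) (sumFin r (λ c → mask ⌊ g j c ≟ v ⌋ (h v)))))
    ≡⟨ sum-cong k (λ j → trans (sum-mask n (P j) _) (cong (mask (P j)) (sum-swap n r _))) ⟩
  sumFin k (λ j → mask (P j) (sumFin r (λ c → sumFin n (λ v → mask ⌊ g j c ≟ v ⌋ (h v)))))
    ≡⟨ sum-cong k (λ j → cong (mask (P j)) (sum-cong r (λ c → sum-delta n (g j c) h))) ⟩
  sumFin k (λ j → mask (P j) (sumFin r (λ c → h (g j c))))
    ∎
  where
  open ≤-Reasoning
  by-block : ∀ v j → mask (P j ∧ anyFin r (λ c → ⌊ g j c ≟ v ⌋)) (h v) ≤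
                     mask (P j) (sumFin r (λ c → mask ⌊ g j c ≟ v ⌋ (h v)))
  by-block v j rewrite mask-∧ (P j) (anyFin r (λ c → ⌊ g j c ≟ v ⌋)) (h v) = mask-mono (P j) (mask-anyFin≤ r _ (h v))

arcs-to-coveredBy≤ : ∀ {n k r} (a : Adj n) (X : VSet n) (g : Fin k → Fin r → Fin n) (Q : Fin k → Bool) →
  arcs a X (coveredBy g Q) ≤
  sumFin n (λ u → mask (X u) (sumFin k (λ j → mask (Q j) (sumFin r (λ c → ⟦ a u (g j c) ⟧)))))
arcs-to-coveredBy≤ {n} a X g Q = sum-mono n (λ u → mask-mono (X u) (sum-coveredBy≤ g Q (λ v → ⟦ a u v ⟧)))

arcs-between-coveredBy≤ : ∀ {n k r k′ r′} (a : Adj n) (g : Fin k → Fin r → Fin n) (P : Fin k → Bool)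
  (g′ : Fin k′ → Fin r′ → Fin n) (Q : Fin k′ → Bool) →
  arcs a (coveredBy g P) (coveredBy g′ Q) ≤
  sumFin k (λ j → mask (P j) (sumFin k′ (λ j′ → mask (Q j′) (blockArcs a (g j) (g′ j′)))))
arcs-between-coveredBy≤ {n} {k} {r} {k′} {r′} a g P g′ Q = begin
  arcs a (coveredBy g P) (coveredBy g′ Q)
    ≤⟨ sum-coveredBy≤ g P _ ⟩
  sumFin k (λ j → mask (P j) (sumFin r (λ c → sumFin n (λ v → mask (coveredBy g′ Q v) ⟦ a (g j c) v ⟧))))
    ≤⟨ sum-mono k (λ j → mask-mono (P j) (sum-mono r (λ c → sum-coveredBy≤ g′ Q (λ v → ⟦ a (g j c) v ⟧)))) ⟩
  sumFin k (λ j → mask (P j) (sumFin r (λ c →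
    sumFin k′ (λ j′ → mask (Q j′) (sumFin r′ (λ c′ → ⟦ a (g j c) (g′ j′ c′) ⟧))))))
    ≡⟨ sum-cong k (λ j → cong (mask (P j)) (trans (sum-swap r k′ _) (sum-cong k′ (λ j′ → sum-mask r (Q j′) _)))) ⟩
  sumFin k (λ j → mask (P j) (sumFin k′ (λ j′ → mask (Q j′) (blockArcs a (g j) (g′ j′)))))
    ∎
  where open ≤-Reasoning

diagonal-offDiagonal-bound : ∀ k (P : Fin k → Bool) (W : Fin k → Fin k → ℕ) α β →
  (∀ j → P j ≡ true → W j j ≤ α) →
  (∀ j j′ → P j ≡ true → P j′ ≡ true → j′ ≢ j → W j j′ ≤ β) →
  sumFin k (λ j → mask (P j) (sumFin k (λ j′ → mask (P j′) (W j j′)))) ≤ countFin k P * (α + β * (countFin k P ∸ 1))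
diagonal-offDiagonal-bound k P W α β diag offDiag =
  sum-mask≤count* k P _ _ row
  where
  row : ∀ j → P j ≡ true → sumFin k (λ j′ → mask (P j′) (W j j′)) ≤ α + β * (countFin k P ∸ 1)
  row j pj = begin
    sumFin k (λ j′ → mask (P j′) (W j j′))
      ≡⟨ sum-extract k _ j ⟩
    mask (P j) (W j j) + sumFin k (λ i → mask (not ⌊ i ≟ j ⌋) (mask (P i) (W j i)))
      ≤⟨ +-mono-≤ (≤-trans (mask≤ (P j) _) (diag j pj)) (sum-mono k off) ⟩
    α + sumFin k (λ i → β * mask (not ⌊ i ≟ j ⌋) ⟦ P i ⟧)
      ≡⟨ cong (α +_) (sum-*ˡ k β _) ⟩
    α + β * sumFin k (λ i → mask (not ⌊ i ≟ j ⌋) ⟦ P i ⟧)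
      ≡⟨ cong (λ x → α + β * (x ∸ 1)) (count-extract k P j pj) ⟨
    α + β * (countFin k P ∸ 1)
      ∎
    where
    open ≤-Reasoning
    off′ : ∀ i → i ≢ j → ∀ b → P i ≡ b → mask b (W j i) ≤ β * ⟦ b ⟧
    off′ i i≢j false _  = z≤n
    off′ i i≢j true  pi = ≤-trans (offDiag j i pj pi i≢j) (≤-reflexive (sym (*-identityʳ β)))
    off : ∀ i → mask (not ⌊ i ≟ j ⌋) (mask (P i) (W j i)) ≤ β * mask (not ⌊ i ≟ j ⌋) ⟦ P i ⟧
    off i with i ≟ j
    ... | yes _   = ≤-reflexive (sym (*-zeroʳ β))
    ... | no i≢j  = off′ i i≢j (P i) refl

count-all : ∀ k → countFin k (λ _ → true) ≡ k
count-all k = trans (sum-const k 1) (*-identityʳ k)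

count-others : ∀ k (j : Fin k) → sumFin k (λ i → mask (not ⌊ i ≟ j ⌋) 1) ≡ k ∸ 1
count-others k j = cong (_∸ 1) (trans (sym (count-extract k (λ _ → true) j refl)) (count-all k))

module _ {n} (G : Graph n) where

  private
    a = adj G

  blockArcs-self≤ : ∀ {r} (s : Fin r → Fin n) → blockArcs a s s ≤ r * (r ∸ 1)
  blockArcs-self≤ {r} s = ≤-trans (sum-mono r row) (≤-reflexive (sum-const r (r ∸ 1)))
    where
    row : ∀ c → sumFin r (λ c′ → ⟦ a (s c) (s c′) ⟧) ≤ r ∸ 1
    row c = begin
      sumFin r (λ c′ → ⟦ a (s c) (s c′) ⟧)
        ≡⟨ sum-extract r _ c ⟩
      ⟦ a (s c) (s c) ⟧ + sumFin r (λ c′ → mask (not ⌊ c′ ≟ c ⌋) ⟦ a (s c) (s c′) ⟧)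
        ≡⟨ cong (λ b → ⟦ b ⟧ + sumFin r (λ c′ → mask (not ⌊ c′ ≟ c ⌋) ⟦ a (s c) (s c′) ⟧)) (irrefl G (s c)) ⟩
      sumFin r (λ c′ → mask (not ⌊ c′ ≟ c ⌋) ⟦ a (s c) (s c′) ⟧)
        ≤⟨ sum-mono r (λ c′ → mask-mono (not ⌊ c′ ≟ c ⌋) (mask≤ (a (s c) (s c′)) 1)) ⟩
      sumFin r (λ c′ → mask (not ⌊ c′ ≟ c ⌋) 1)
        ≡⟨ count-others r c ⟩
      r ∸ 1
        ∎
      where open ≤-Reasoning

  blockArcs-rows≤ : ∀ {r r′} (s : Fin r → Fin n) (t : Fin r′ → Fin n) b →
    (∀ c → sumFin r′ (λ c′ → ⟦ a (s c) (t c′) ⟧) ≤ b) → blockArcs a s t ≤ r * b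
  blockArcs-rows≤ {r} s t b row = ≤-trans (sum-mono r row) (≤-reflexive (sum-const r b))

  eBetween-vertices-coveredBy≤ : ∀ {k r} (X : VSet n) (g : Fin k → Fin r → Fin n) (Q : Fin k → Bool) β →
    (∀ u j → X u ≡ true → Q j ≡ true → sumFin r (λ c → ⟦ a u (g j c) ⟧) ≤ β) →
    eBetween a X (coveredBy g Q) ≤ countFin n X * (countFin k Q * β)
  eBetween-vertices-coveredBy≤ {k} X g Q β bound = begin
    eBetween a X (coveredBy g Q)  ≤⟨ eBetween≤arcs G X (coveredBy g Q) ⟩
    arcs a X (coveredBy g Q)      ≤⟨ arcs-to-coveredBy≤ a X g Q ⟩
    _                             ≤⟨ sum-mask≤count* n X _ _ (λ u xu →
                                       sum-mask≤count* k Q _ β (λ j qj → bound u j xu qj)) ⟩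
    countFin n X * (countFin k Q * β) ∎
    where open ≤-Reasoning

  eBetween-coveredBy≤ : ∀ {k r k′ r′} (g : Fin k → Fin r → Fin n) (P : Fin k → Bool)
    (g′ : Fin k′ → Fin r′ → Fin n) (Q : Fin k′ → Bool) β →
    (∀ j j′ → P j ≡ true → Q j′ ≡ true → blockArcs a (g j) (g′ j′) ≤ β) →
    eBetween a (coveredBy g P) (coveredBy g′ Q) ≤ countFin k P * (countFin k′ Q * β)
  eBetween-coveredBy≤ {k} {k′ = k′} g P g′ Q β bound = begin
    eBetween a (coveredBy g P) (coveredBy g′ Q)  ≤⟨ eBetween≤arcs G _ _ ⟩
    arcs a (coveredBy g P) (coveredBy g′ Q)      ≤⟨ arcs-between-coveredBy≤ a g P g′ Q ⟩
    _                                            ≤⟨ sum-mask≤count* k P _ _ (λ j pj →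
                                                      sum-mask≤count* k′ Q _ β (λ j′ qj′ → bound j j′ pj qj′)) ⟩
    countFin k P * (countFin k′ Q * β)           ∎
    where open ≤-Reasoning

  eIn-coveredBy≤ : ∀ {k r} (g : Fin k → Fin r → Fin n) (P : Fin k → Bool) α β →
    (∀ j → P j ≡ true → blockArcs a (g j) (g j) ≤ α) →
    (∀ j j′ → P j ≡ true → P j′ ≡ true → j′ ≢ j → blockArcs a (g j) (g j′) ≤ β) →
    eIn a (coveredBy g P) + eIn a (coveredBy g P) ≤ countFin k P * (α + β * (countFin k P ∸ 1))
  eIn-coveredBy≤ {k} g P α β diag offDiag = begin
    eIn a (coveredBy g P) + eIn a (coveredBy g P)  ≤⟨ eIn+eIn≤arcs G _ ⟩
    arcs a (coveredBy g P) (coveredBy g P)         ≤⟨ arcs-between-coveredBy≤ a g P g P ⟩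
    _                                              ≤⟨ diagonal-offDiagonal-bound k P _ α β diag offDiag ⟩
    countFin k P * (α + β * (countFin k P ∸ 1))    ∎
    where open ≤-Reasoning

Disjoint : ∀ {A : Set} → (A → Bool) → (A → Bool) → Set
Disjoint P R = ∀ i → P i ∧ R i ≡ false

module _ {n} (a : Adj n) where

  eIn-∪≤ : ∀ (Z X J : VSet n) → (∀ v → Z v ≡ X v ∨ J v) → eIn a Z ≤ eIn a X + eIn a J + eBetween a X J
  eIn-∪≤ Z X J Z≗X∪J = begin
    eIn a Z                                        ≤⟨ sum²-mono n split ⟩
    sum² n (λ u v → inX u v + inJ u v + across u v)         ≡⟨ sum²-+ n (λ u v → inX u v + inJ u v) across ⟩
    sum² n (λ u v → inX u v + inJ u v) + sum² n across      ≡⟨ cong (_+ sum² n across) (sum²-+ n inX inJ) ⟩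
    eIn a X + eIn a J + eBetween a X J             ∎
    where
    open ≤-Reasoning
    inX inJ across : Fin n → Fin n → ℕ
    inX u v = ⟦ u ≺ v ∧ X u ∧ X v ∧ a u v ⟧
    inJ u v = ⟦ u ≺ v ∧ J u ∧ J v ∧ a u v ⟧
    across u v = ⟦ u ≺ v ∧ a u v ∧ ((X u ∧ J v) ∨ (J u ∧ X v)) ⟧
    split : ∀ u v → ⟦ u ≺ v ∧ Z u ∧ Z v ∧ a u v ⟧ ≤ inX u v + inJ u v + across u v
    split u v rewrite Z≗X∪J u | Z≗X∪J v = ≤ᵇ⇒≤ _ _ (table (u ≺ v) (a u v) (X u) (X v) (J u) (J v))
      where
      table : Valid 6 λ l e x x′ j j′ →
        ⟦ l ∧ (x ∨ j) ∧ (x′ ∨ j′) ∧ e ⟧ ≤ᵇ ⟦ l ∧ x ∧ x′ ∧ e ⟧ + ⟦ l ∧ j ∧ j′ ∧ e ⟧ + ⟦ l ∧ e ∧ ((x ∧ j′) ∨ (j ∧ x′)) ⟧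
      table = tautology 6 _

  eBetween-∪ˡ≤ : ∀ (Z X J R : VSet n) → (∀ v → Z v ≡ X v ∨ J v) → eBetween a Z R ≤ eBetween a X R + eBetween a J R
  eBetween-∪ˡ≤ Z X J R Z≗X∪J = ≤-trans (sum²-mono n split) (≤-reflexive (sum²-+ n _ _))
    where
    split : ∀ u v → ⟦ u ≺ v ∧ a u v ∧ ((Z u ∧ R v) ∨ (R u ∧ Z v)) ⟧ ≤
                    ⟦ u ≺ v ∧ a u v ∧ ((X u ∧ R v) ∨ (R u ∧ X v)) ⟧ + ⟦ u ≺ v ∧ a u v ∧ ((J u ∧ R v) ∨ (R u ∧ J v)) ⟧
    split u v rewrite Z≗X∪J u | Z≗X∪J v = ≤ᵇ⇒≤ _ _ (table (u ≺ v) (a u v) (X u) (J u) (R v) (R u) (X v) (J v))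
      where
      table : Valid 8 λ l e x j r′ r x′ j′ →
        ⟦ l ∧ e ∧ (((x ∨ j) ∧ r′) ∨ (r ∧ (x′ ∨ j′))) ⟧ ≤ᵇ
        ⟦ l ∧ e ∧ ((x ∧ r′) ∨ (r ∧ x′)) ⟧ + ⟦ l ∧ e ∧ ((j ∧ r′) ∨ (r ∧ j′)) ⟧
      table = tautology 8 _

  eBetween-∪ʳ≥ : ∀ (X J R Y : VSet n) → (∀ v → Y v ≡ R v ∨ J v) →
    Disjoint X J → Disjoint X R → Disjoint R J → eBetween a X R + eBetween a X J ≤ eBetween a X Y
  eBetween-∪ʳ≥ X J R Y Y≗R∪J X∩J X∩R R∩J = ≤-trans (≤-reflexive (sym (sum²-+ n _ _))) (sum²-mono n merge)
    where
    merge : ∀ u v → ⟦ u ≺ v ∧ a u v ∧ ((X u ∧ R v) ∨ (R u ∧ X v)) ⟧ +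
                    ⟦ u ≺ v ∧ a u v ∧ ((X u ∧ J v) ∨ (J u ∧ X v)) ⟧ ≤
                    ⟦ u ≺ v ∧ a u v ∧ ((X u ∧ Y v) ∨ (Y u ∧ X v)) ⟧
    merge u v rewrite Y≗R∪J u | Y≗R∪J v =
      ≤ᵇ⇒≤ _ _ (resolve (R∩J v) (resolve (R∩J u) (resolve (X∩R v) (resolve (X∩R u) (resolve (X∩J v) (resolve (X∩J u)
        (table (u ≺ v) (a u v) (X u) (X v) (J u) (J v) (R u) (R v))))))))
      where
      table : Valid 8 λ l e x x′ j j′ r r′ →
        (x ∧ j) ∨ (x′ ∧ j′) ∨ (x ∧ r) ∨ (x′ ∧ r′) ∨ (r ∧ j) ∨ (r′ ∧ j′) ∨
        (⟦ l ∧ e ∧ ((x ∧ r′) ∨ (r ∧ x′)) ⟧ + ⟦ l ∧ e ∧ ((x ∧ j′) ∨ (j ∧ x′)) ⟧ ≤ᵇ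
         ⟦ l ∧ e ∧ ((x ∧ (r′ ∨ j′)) ∨ ((r ∨ j) ∧ x′)) ⟧)
      table = tautology 8 _

  eIn-empty : ∀ X → (∀ v → X v ≡ false) → eIn a X ≡ 0
  eIn-empty X empty = n≤0⇒n≡0 (≤-trans (sum²-mono n none) (≤-reflexive (sum²-zero n)))
    where
    none : ∀ u v → ⟦ u ≺ v ∧ X u ∧ X v ∧ a u v ⟧ ≤ 0
    none u v rewrite empty u = ≤ᵇ⇒≤ _ _ (table (u ≺ v) (X v ∧ a u v))
      where
      table : Valid 2 λ l r → ⟦ l ∧ false ∧ r ⟧ ≤ᵇ 0
      table = tautology 2 _

  eBetween-emptyˡ : ∀ X Y → (∀ v → X v ≡ false) → eBetween a X Y ≡ 0
  eBetween-emptyˡ X Y empty = n≤0⇒n≡0 (≤-trans (sum²-mono n none) (≤-reflexive (sum²-zero n)))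
    where
    none : ∀ u v → ⟦ u ≺ v ∧ a u v ∧ ((X u ∧ Y v) ∨ (Y u ∧ X v)) ⟧ ≤ 0
    none u v rewrite empty u | empty v = ≤ᵇ⇒≤ _ _ (table (u ≺ v) (a u v) (Y u) (Y v))
      where
      table : Valid 4 λ l e y y′ → ⟦ l ∧ e ∧ ((false ∧ y′) ∨ (y ∧ false)) ⟧ ≤ᵇ 0
      table = tautology 4 _

suc-C2 : ∀ t → suc t C 2 ≡ t + t C 2
suc-C2 t = trans (sym (nCk+nC[k+1]≡[n+1]C[k+1] t 1)) (cong (_+ t C 2) (nC1≡n t))

C2*2 : ∀ t → (t C 2) * 2 ≡ t * (t ∸ 1)
C2*2 zero    = refl
C2*2 (suc t) = begin
  (suc t C 2) * 2         ≡⟨ cong (_* 2) (suc-C2 t) ⟩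
  (t + t C 2) * 2         ≡⟨ *-distribʳ-+ 2 t (t C 2) ⟩
  t * 2 + (t C 2) * 2     ≡⟨ cong (t * 2 +_) (C2*2 t) ⟩
  t * 2 + t * (t ∸ 1)     ≡⟨ lemma t ⟩
  suc t * t               ∎
  where
  open ≡-Reasoning
  lemma : ∀ t → t * 2 + t * (t ∸ 1) ≡ suc t * t
  lemma zero    = refl
  lemma (suc s) = ring s
    where
    ring : ∀ s → suc s * 2 + suc s * s ≡ suc (suc s) * suc s
    ring = solve-∀

C2-+ : ∀ a b → (a + b) C 2 ≡ a C 2 + b C 2 + a * b
C2-+ zero    b = sym (+-identityʳ (b C 2))
C2-+ (suc a) b = begin
  suc (a + b) C 2                     ≡⟨ suc-C2 (a + b) ⟩
  (a + b) + (a + b) C 2               ≡⟨ cong ((a + b) +_) (C2-+ a b) ⟩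
  (a + b) + (a C 2 + b C 2 + a * b)   ≡⟨ ring a b (a C 2) (b C 2) ⟩
  (a + a C 2) + b C 2 + suc a * b     ≡⟨ cong (λ x → x + b C 2 + suc a * b) (suc-C2 a) ⟨
  suc a C 2 + b C 2 + suc a * b       ∎
  where
  open ≡-Reasoning
  ring : ∀ a b x y → (a + b) + (x + y + a * b) ≡ (a + x) + y + suc a * b
  ring = solve-∀

m+m≤n+n⇒m≤n : ∀ {m n} → m + m ≤ n + n → m ≤ n
m+m≤n+n⇒m≤n {m} {n} h with m ≤? n
... | yes m≤n = m≤n
... | no  m≰n = contradiction h (<⇒≱ (+-mono-< (≰⇒> m≰n) (≰⇒> m≰n)))

double≤⇒≤binomial : ∀ β t E → E + E ≤ t * (6 + β * (t ∸ 1)) → E ≤ β * (t C 2) + 3 * t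
double≤⇒≤binomial β t E h = m+m≤n+n⇒m≤n (subst (E + E ≤_) twice h)
  where
  open ≡-Reasoning
  twice : t * (6 + β * (t ∸ 1)) ≡ (β * (t C 2) + 3 * t) + (β * (t C 2) + 3 * t)
  twice = begin
    t * (6 + β * (t ∸ 1))                           ≡⟨ distrib t β (t ∸ 1) ⟩
    t * 6 + β * (t * (t ∸ 1))                       ≡⟨ cong (λ x → t * 6 + β * x) (C2*2 t) ⟨
    t * 6 + β * ((t C 2) * 2)                       ≡⟨ regroup t β (t C 2) ⟩
    (β * (t C 2) + 3 * t) + (β * (t C 2) + 3 * t)   ∎
    where
    distrib : ∀ t β u → t * (6 + β * u) ≡ t * 6 + β * (t * u)
    distrib = solve-∀
    regroup : ∀ t β c → t * 6 + β * (c * 2) ≡ (β * c + 3 * t) + (β * c + 3 * t)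
    regroup = solve-∀

double≤⇒≤square : ∀ m E → E + E ≤ m * (2 + 2 * (m ∸ 1)) → E ≤ m * m
double≤⇒≤square zero    E h = m+m≤n+n⇒m≤n h
double≤⇒≤square (suc s) E h = m+m≤n+n⇒m≤n (subst (E + E ≤_) (ring s) h)
  where
  ring : ∀ s → suc s * (2 + 2 * s) ≡ suc s * suc s + suc s * suc s
  ring = solve-∀

tri : ∀ {n} → Fin n → Fin n → Fin n → Fin 3 → Fin n
tri x y z zero             = x
tri x y z (suc zero)       = y
tri x y z (suc (suc zero)) = z

edge : ∀ {n} → Fin n → Fin n → Fin 2 → Fin n
edge x y zero       = x
edge x y (suc zero) = y

tri-all : ∀ {n} {P : Fin n → Set} {x y z} → P x → P y → P z → ∀ d → P (tri x y z d)
tri-all px py pz zero             = px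
tri-all px py pz (suc zero)       = py
tri-all px py pz (suc (suc zero)) = pz

≢tri : ∀ {n} {v x y z : Fin n} → v ≢ x → v ≢ y → v ≢ z → ∀ d → v ≢ tri x y z d
≢tri {v = v} = tri-all {P = v ≢_}

Avoids : ∀ {n k} → (Fin k → Fin 3 → Fin n) → Fin n → Set
Avoids T v = ∀ j d → v ≢ T j d

AvoidsExcept : ∀ {n k} → (Fin k → Fin 3 → Fin n) → Fin k → Fin n → Set
AvoidsExcept T j v = ∀ j′ d → j′ ≢ j → v ≢ T j′ d

avoids⇒avoidsExcept : ∀ {n k} {T : Fin k → Fin 3 → Fin n} {j v} → Avoids T v → AvoidsExcept T j v
avoids⇒avoidsExcept v∉T j′ d _ = v∉T j′ d

replaceAt : ∀ {n k} → Fin k → (Fin 3 → Fin n) → (Fin k → Fin 3 → Fin n) → Fin k → Fin 3 → Fin n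
replaceAt j t T j′ = if ⌊ j′ ≟ j ⌋ then t else T j′

replaceAt-view : ∀ {n k} (j : Fin k) (t : Fin 3 → Fin n) T j′ →
  (j′ ≡ j × replaceAt j t T j′ ≡ t) ⊎ (j′ ≢ j × replaceAt j t T j′ ≡ T j′)
replaceAt-view j t T j′ with j′ ≟ j
... | yes j′≡j = inj₁ (j′≡j , refl)
... | no  j′≢j = inj₂ (j′≢j , refl)

avoids-replaceAt : ∀ {n k} {T : Fin k → Fin 3 → Fin n} {j t v} →
  (∀ d → v ≢ t d) → AvoidsExcept T j v → Avoids (replaceAt j t T) v
avoids-replaceAt {T = T} {j} {t} {v} v∉t v∉T j′ d with replaceAt-view j t T j′
... | inj₁ (_ , e)    = subst (λ s → v ≢ s d) (sym e) (v∉t d)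
... | inj₂ (j′≢j , e) = subst (λ s → v ≢ s d) (sym e) (v∉T j′ d j′≢j)

avoidsExcept-replaceAt : ∀ {n k} {T : Fin k → Fin 3 → Fin n} {j j₂ t v} →
  (∀ d → v ≢ t d) → (∀ j′ d → j′ ≢ j → j′ ≢ j₂ → v ≢ T j′ d) → AvoidsExcept (replaceAt j t T) j₂ v
avoidsExcept-replaceAt {T = T} {j} {j₂} {t} {v} v∉t v∉T j′ d j′≢j₂ with replaceAt-view j t T j′
... | inj₁ (_ , e)    = subst (λ s → v ≢ s d) (sym e) (v∉t d)
... | inj₂ (j′≢j , e) = subst (λ s → v ≢ s d) (sym e) (v∉T j′ d j′≢j j′≢j₂)

_◂_ : ∀ {n k} → (Fin 3 → Fin n) → (Fin k → Fin 3 → Fin n) → Fin (suc k) → Fin 3 → Fin n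
(t ◂ T) zero    = t
(t ◂ T) (suc j) = T j

consEdge : ∀ {n m} → Fin n → Fin n → (Fin m → Fin 2 → Fin n) → Fin (suc m) → Fin 2 → Fin n
consEdge u v M zero    = edge u v
consEdge u v M (suc l) = M l

module Surgery {n} (G : Graph n) where

  private
    a = adj G

  adj-sym : ∀ {u v} → a u v ≡ true → a v u ≡ true
  adj-sym {u} {v} e = trans (Graph.sym G v u) e

  adj⇒≢ : ∀ {u v} → a u v ≡ true → u ≢ v
  adj⇒≢ {u} e refl = contradiction (trans (sym e) (irrefl G u)) λ ()

  triangle-adj : ∀ {t} → IsTriangle a t → ∀ c c′ → c ≢ c′ → a (t c) (t c′) ≡ true
  triangle-adj (p , q , r) zero             zero             c≢c′ = contradiction refl c≢c′
  triangle-adj (p , q , r) zero             (suc zero)       _    = p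
  triangle-adj (p , q , r) zero             (suc (suc zero)) _    = r
  triangle-adj (p , q , r) (suc zero)       zero             _    = adj-sym p
  triangle-adj (p , q , r) (suc zero)       (suc zero)       c≢c′ = contradiction refl c≢c′
  triangle-adj (p , q , r) (suc zero)       (suc (suc zero)) _    = q
  triangle-adj (p , q , r) (suc (suc zero)) zero             _    = adj-sym r
  triangle-adj (p , q , r) (suc (suc zero)) (suc zero)       _    = adj-sym q
  triangle-adj (p , q , r) (suc (suc zero)) (suc (suc zero)) c≢c′ = contradiction refl c≢c′

  triangle-injective : ∀ {t} → IsTriangle a t → ∀ c c′ → t c ≡ t c′ → c ≡ c′
  triangle-injective t△ c c′ e with c ≟ c′
  ... | yes c≡c′ = c≡c′
  ... | no  c≢c′ = contradiction e (adj⇒≢ (triangle-adj t△ c c′ c≢c′))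

  replaceAt-disjoint : ∀ {k} (T : Fin k → Fin 3 → Fin n) j t → IsDisjTriangles a T → IsTriangle a t →
    (∀ c → AvoidsExcept T j (t c)) → IsDisjTriangles a (replaceAt j t T)
  replaceAt-disjoint T j t (T-inj , T△) t△ t∉T = inj , tris
    where
    via : ∀ {j₁ j₂ c₁ c₂ s₁ s₂} → replaceAt j t T j₁ ≡ s₁ → replaceAt j t T j₂ ≡ s₂ →
      replaceAt j t T j₁ c₁ ≡ replaceAt j t T j₂ c₂ → s₁ c₁ ≡ s₂ c₂
    via e₁ e₂ e = trans (sym (cong-app e₁ _)) (trans e (cong-app e₂ _))
    inj : ∀ j₁ j₂ c₁ c₂ → replaceAt j t T j₁ c₁ ≡ replaceAt j t T j₂ c₂ → (j₁ ≡ j₂) × (c₁ ≡ c₂)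
    inj j₁ j₂ c₁ c₂ e with replaceAt-view j t T j₁ | replaceAt-view j t T j₂
    ... | inj₁ (j₁≡j , e₁) | inj₁ (j₂≡j , e₂) = trans j₁≡j (sym j₂≡j) , triangle-injective t△ c₁ c₂ (via e₁ e₂ e)
    ... | inj₁ (_ , e₁)    | inj₂ (j₂≢j , e₂) = contradiction (via e₁ e₂ e) (t∉T c₁ j₂ c₂ j₂≢j)
    ... | inj₂ (j₁≢j , e₁) | inj₁ (_ , e₂)    = contradiction (sym (via e₁ e₂ e)) (t∉T c₂ j₁ c₁ j₁≢j)
    ... | inj₂ (_ , e₁)    | inj₂ (_ , e₂)    = T-inj j₁ j₂ c₁ c₂ (via e₁ e₂ e)
    tris : ∀ j′ → IsTriangle a (replaceAt j t T j′)
    tris j′ with replaceAt-view j t T j′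
    ... | inj₁ (_ , e) = subst (IsTriangle a) (sym e) t△
    ... | inj₂ (_ , e) = subst (IsTriangle a) (sym e) (T△ j′)

  ◂-disjoint : ∀ {k} (T : Fin k → Fin 3 → Fin n) t → IsDisjTriangles a T → IsTriangle a t →
    (∀ c → Avoids T (t c)) → HasDisjTriangles a (suc k)
  ◂-disjoint T t (T-inj , T△) t△ t∉T = t ◂ T , inj , tris
    where
    inj : ∀ j₁ j₂ c₁ c₂ → (t ◂ T) j₁ c₁ ≡ (t ◂ T) j₂ c₂ → (j₁ ≡ j₂) × (c₁ ≡ c₂)
    inj zero      zero      c₁ c₂ e = refl , triangle-injective t△ c₁ c₂ e
    inj zero      (suc j₂)  c₁ c₂ e = contradiction e (t∉T c₁ j₂ c₂)
    inj (suc j₁)  zero      c₁ c₂ e = contradiction (sym e) (t∉T c₂ j₁ c₁)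
    inj (suc j₁)  (suc j₂)  c₁ c₂ e with T-inj j₁ j₂ c₁ c₂ e
    ... | refl , c₁≡c₂ = refl , c₁≡c₂
    tris : ∀ j′ → IsTriangle a ((t ◂ T) j′)
    tris zero     = t△
    tris (suc j′) = T△ j′

  replaceAt-matching : ∀ {k m} (T : Fin k → Fin 3 → Fin n) j t (M : Fin m → Fin 2 → Fin n) →
    IsMatchingAvoiding a T M → (∀ l c d → M l c ≢ t d) → IsMatchingAvoiding a (replaceAt j t T) M
  replaceAt-matching T j t M (M-inj , M-edge , M∉T) M∉t =
    M-inj , M-edge , λ l c → avoids-replaceAt (M∉t l c) (λ j′ d _ → M∉T l c j′ d)

  consEdge-matching : ∀ {k m} (T : Fin k → Fin 3 → Fin n) (M : Fin m → Fin 2 → Fin n) u v →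
    IsMatchingAvoiding a T M → a u v ≡ true → (∀ l c → M l c ≢ u) → (∀ l c → M l c ≢ v) →
    Avoids T u → Avoids T v → IsMatchingAvoiding a T (consEdge u v M)
  consEdge-matching T M u v (M-inj , M-edge , M∉T) uv u∉M v∉M u∉T v∉T = inj , edges , avoids
    where
    inj : ∀ l l′ c c′ → consEdge u v M l c ≡ consEdge u v M l′ c′ → (l ≡ l′) × (c ≡ c′)
    inj zero    zero     zero       zero       e = refl , refl
    inj zero    zero     zero       (suc zero) e = contradiction e (adj⇒≢ uv)
    inj zero    zero     (suc zero) zero       e = contradiction (sym e) (adj⇒≢ uv)
    inj zero    zero     (suc zero) (suc zero) e = refl , refl
    inj zero    (suc l′) zero       c′         e = contradiction (sym e) (u∉M l′ c′)
    inj zero    (suc l′) (suc zero) c′         e = contradiction (sym e) (v∉M l′ c′)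
    inj (suc l) zero     c          zero       e = contradiction e (u∉M l c)
    inj (suc l) zero     c          (suc zero) e = contradiction e (v∉M l c)
    inj (suc l) (suc l′) c          c′         e with M-inj l l′ c c′ e
    ... | refl , c≡c′ = refl , c≡c′
    edges : ∀ l → a (consEdge u v M l e0) (consEdge u v M l e1) ≡ true
    edges zero    = uv
    edges (suc l) = M-edge l
    avoids : ∀ l c j d → consEdge u v M l c ≢ T j d
    avoids zero    zero       = u∉T
    avoids zero    (suc zero) = v∉T
    avoids (suc l) c          = M∉T l c

other₁ other₂ : Fin 3 → Fin 3
other₁ zero             = suc zero
other₁ (suc zero)       = zero
other₁ (suc (suc zero)) = zero
other₂ zero             = suc (suc zero)
other₂ (suc zero)       = suc (suc zero)
other₂ (suc (suc zero)) = suc zero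

other₁≢ : ∀ c → other₁ c ≢ c
other₁≢ zero             ()
other₁≢ (suc zero)       ()
other₁≢ (suc (suc zero)) ()

other₂≢ : ∀ c → other₂ c ≢ c
other₂≢ zero             ()
other₂≢ (suc zero)       ()
other₂≢ (suc (suc zero)) ()

other₁≢other₂ : ∀ c → other₁ c ≢ other₂ c
other₁≢other₂ zero             ()
other₁≢other₂ (suc zero)       ()
other₁≢other₂ (suc (suc zero)) ()

LeftoverMatchingsAtMost : ∀ {n} → Graph n → ℕ → ℕ → Set
LeftoverMatchingsAtMost {n} G k m =
  ∀ (T′ : Fin k → Fin 3 → Fin n) → IsDisjTriangles (adj G) T′ →
  ∀ (m′ : ℕ) (M′ : Fin m′ → Fin 2 → Fin n) → IsMatchingAvoiding (adj G) T′ M′ → m′ ≤ m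

module Extremal {n k : ℕ} (G : Graph n) (EM : EdgeMaximal G k)
  (T : Fin k → Fin 3 → Fin n) (TD : IsDisjTriangles (adj G) T)
  {m : ℕ} (M : Fin m → Fin 2 → Fin n) (MA : IsMatchingAvoiding (adj G) T M)
  (maxM : LeftoverMatchingsAtMost G k m) where

  open Surgery G public
  open Setting G T M public

  a : Adj n
  a = adj G

  I : VSet n
  I = Iset

  x y : Fin m → Fin n
  x l = M l e0
  y l = M l e1

  𝒯-triangle : ∀ j → IsTriangle a (T j)
  𝒯-triangle = proj₂ TD

  opposite-side : ∀ j c → a (T j (other₁ c)) (T j (other₂ c)) ≡ true
  opposite-side j c = triangle-adj {T j} (𝒯-triangle j) (other₁ c) (other₂ c) (other₁≢other₂ c)

  ℳ-edge : ∀ l → a (x l) (y l) ≡ true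
  ℳ-edge = proj₁ (proj₂ MA)

  𝒯-distinct-triangles : ∀ {j j′ d d′} → j ≢ j′ → T j d ≢ T j′ d′
  𝒯-distinct-triangles {j} {j′} {d} {d′} j≢j′ e = j≢j′ (proj₁ (proj₁ TD j j′ d d′ e))

  𝒯-distinct-corners : ∀ {j d d′} → d ≢ d′ → T j d ≢ T j d′
  𝒯-distinct-corners {j} {d} {d′} d≢d′ e = d≢d′ (proj₂ (proj₁ TD j j d d′ e))

  ℳ∉𝒯 : ∀ {l c j d} → M l c ≢ T j d
  ℳ∉𝒯 {l} {c} {j} {d} = proj₂ (proj₂ MA) l c j d

  ℳ-distinct : ∀ {l l′ c c′} → l ≢ l′ → M l c ≢ M l′ c′
  ℳ-distinct {l} {l′} {c} {c′} l≢l′ e = l≢l′ (proj₁ (proj₁ MA l l′ c c′ e))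

  ℐ∉𝒯 : ∀ {u j d} → I u ≡ true → u ≢ T j d
  ℐ∉𝒯 {u} {j} {d} iu u≡Tjd = contradiction (trans (sym (≡⇒≟ (sym u≡Tjd))) uncovered) λ ()
    where
    uncovered : ⌊ T j d ≟ u ⌋ ≡ false
    uncovered = anyFin-false 3 (λ c → ⌊ T j c ≟ u ⌋)
      (anyFin-false k (λ j → true ∧ anyFin 3 (λ c → ⌊ T j c ≟ u ⌋)) (not≡true⇒≡false (∧-elimˡ iu)) j) d

  ℐ∉ℳ : ∀ {u l c} → I u ≡ true → u ≢ M l c
  ℐ∉ℳ {u} {l} {c} iu u≡Mlc = contradiction (trans (sym (≡⇒≟ (sym u≡Mlc))) uncovered) λ ()
    where
    uncovered : ⌊ M l c ≟ u ⌋ ≡ false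
    uncovered = anyFin-false 2 (λ c → ⌊ M l c ≟ u ⌋)
      (anyFin-false m (λ l → anyFin 2 (λ c → ⌊ M l c ≟ u ⌋))
        (not≡true⇒≡false (∧-elimʳ {not (trisV T (λ _ → true) u)} iu)) l) c

  𝒯-corner-only-in : ∀ j d → AvoidsExcept T j (T j d)
  𝒯-corner-only-in j d j′ d′ j′≢j = 𝒯-distinct-triangles (≢-sym j′≢j)

  ℳ-avoids-𝒯 : ∀ l c → Avoids T (M l c)
  ℳ-avoids-𝒯 l c j d = ℳ∉𝒯

  ℐ-avoids-𝒯 : ∀ {u} → I u ≡ true → Avoids T u
  ℐ-avoids-𝒯 iu j d = ℐ∉𝒯 {j = j} {d = d} iu

  EdgeSees : Fin m → Fin n → Set
  EdgeSees l v = edgeSeesVertex a (x l) (y l) v ≡ true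

  edgeSees-triangle : ∀ {l v} → EdgeSees l v → IsTriangle a (tri (x l) (y l) v)
  edgeSees-triangle {l} {v} e =
    ∧-elimˡ e , ∧-elimʳ {a (x l) v} (∧-elimʳ {a (x l) (y l)} e) , ∧-elimˡ (∧-elimʳ {a (x l) (y l)} e)

  SeesSide : Fin n → Fin n → Fin n → Set
  SeesSide w p q = vertexSeesEdge a w p q ≡ true

  seesSide-triangle : ∀ {w p q} → SeesSide w p q → IsTriangle a (tri w p q)
  seesSide-triangle {w} {p} {q} e = ∧-elimˡ e , ∧-elimʳ {a w q} (∧-elimʳ {a w p} e) , ∧-elimˡ (∧-elimʳ {a w p} e)

  SeesOpposite : Fin n → Fin k → Fin 3 → Set
  SeesOpposite w j d = SeesSide w (T j (other₁ d)) (T j (other₂ d))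

  no-triangle-avoiding-𝒯 : ∀ t → IsTriangle a t → (∀ c → Avoids T (t c)) → ⊥
  no-triangle-avoiding-𝒯 t t△ t∉T = proj₁ EM (◂-disjoint T t TD t△ t∉T)

  no-larger-matching : ∀ T′ → IsDisjTriangles a T′ →
    (M′ : Fin (suc m) → Fin 2 → Fin n) → IsMatchingAvoiding a T′ M′ → ⊥
  no-larger-matching T′ T′D M′ M′A = 1+n≰n (maxM T′ T′D (suc m) M′ M′A)

  module EdgeSwap (j : Fin k) (l : Fin m) (c : Fin 3) (s : EdgeSees l (T j c)) where
    T′ = replaceAt j (tri (x l) (y l) (T j c)) T

    T′-disjoint : IsDisjTriangles a T′
    T′-disjoint = replaceAt-disjoint T j _ TD (edgeSees-triangle s)
      (tri-all {P = AvoidsExcept T j} (avoids⇒avoidsExcept (ℳ-avoids-𝒯 l e0))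
                                       (avoids⇒avoidsExcept (ℳ-avoids-𝒯 l e1)) (𝒯-corner-only-in j c))

    𝒯-avoids-T′ : ∀ {d} → d ≢ c → Avoids T′ (T j d)
    𝒯-avoids-T′ d≢c = avoids-replaceAt (≢tri (≢-sym ℳ∉𝒯) (≢-sym ℳ∉𝒯) (𝒯-distinct-corners d≢c))
                        (λ _ _ j′≢j → 𝒯-distinct-triangles (≢-sym j′≢j))

  module VertexSwap (j : Fin k) (w : Fin n) (iw : I w ≡ true) (d : Fin 3) (s : SeesOpposite w j d) where
    T′ = replaceAt j (tri w (T j (other₁ d)) (T j (other₂ d))) T

    T′-disjoint : IsDisjTriangles a T′
    T′-disjoint = replaceAt-disjoint T j _ TD (seesSide-triangle s)
      (tri-all {P = AvoidsExcept T j} (avoids⇒avoidsExcept (ℐ-avoids-𝒯 iw))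
                                       (𝒯-corner-only-in j (other₁ d)) (𝒯-corner-only-in j (other₂ d)))

    M-avoids-T′ : IsMatchingAvoiding a T′ M
    M-avoids-T′ = replaceAt-matching T j _ M MA (λ l c → ≢tri (≢-sym (ℐ∉ℳ iw)) ℳ∉𝒯 ℳ∉𝒯)

    corner-avoids-T′ : Avoids T′ (T j d)
    corner-avoids-T′ = avoids-replaceAt
      (≢tri (≢-sym (ℐ∉𝒯 iw)) (𝒯-distinct-corners (≢-sym (other₁≢ d))) (𝒯-distinct-corners (≢-sym (other₂≢ d))))
      (λ _ _ j′≢j → 𝒯-distinct-triangles (≢-sym j′≢j))

  ℐ-independent : ∀ {u v} → I u ≡ true → I v ≡ true → a u v ≡ true → ⊥
  ℐ-independent {u} {v} iu iv uv = no-larger-matching T TD (consEdge u v M)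
    (consEdge-matching T M u v MA uv (λ _ _ → ≢-sym (ℐ∉ℳ iu)) (λ _ _ → ≢-sym (ℐ∉ℳ iv))
                                     (ℐ-avoids-𝒯 iu) (ℐ-avoids-𝒯 iv))

  -- Replace T j by the triangle l sees; l′ then forms a triangle with T j c′.
  edges-see-same-corner : ∀ {j l l′ c c′} → l ≢ l′ → EdgeSees l (T j c) → EdgeSees l′ (T j c′) → c ≡ c′
  edges-see-same-corner {j} {l} {l′} {c} {c′} l≢l′ s s′ with c ≟ c′
  ... | yes c≡c′ = c≡c′
  ... | no  c≢c′ = ⊥-elim (proj₁ EM (◂-disjoint T′ _ T′-disjoint (edgeSees-triangle s′)
                     (tri-all {P = Avoids T′} (l′-avoids e0) (l′-avoids e1) (𝒯-avoids-T′ (≢-sym c≢c′)))))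
    where
    open EdgeSwap j l c s
    l′-avoids : ∀ c₀ → Avoids T′ (M l′ c₀)
    l′-avoids c₀ = avoids-replaceAt (≢tri (ℳ-distinct (≢-sym l≢l′)) (ℳ-distinct (≢-sym l≢l′)) ℳ∉𝒯)
                     (avoids⇒avoidsExcept (ℳ-avoids-𝒯 l′ c₀))

  -- Replace T j by the triangle l sees; u then forms a triangle with the side of T j opposite c.
  corner-seen⇒ℐ-misses-opposite-side : ∀ {j l c u} → EdgeSees l (T j c) → I u ≡ true →
    a u (T j (other₁ c)) ≡ true → a u (T j (other₂ c)) ≡ true → ⊥
  corner-seen⇒ℐ-misses-opposite-side {j} {l} {c} {u} s iu u₁ u₂ =
    proj₁ EM (◂-disjoint T′ _ T′-disjoint (u₁ , opposite-side j c , u₂)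
      (tri-all {P = Avoids T′} (avoids-replaceAt (≢tri (ℐ∉ℳ iu) (ℐ∉ℳ iu) (ℐ∉𝒯 iu))
                                                 (avoids⇒avoidsExcept (ℐ-avoids-𝒯 iu)))
                               (𝒯-avoids-T′ (other₁≢ c)) (𝒯-avoids-T′ (other₂≢ c))))
    where open EdgeSwap j l c s

  -- Replace T j by the triangle w sees; u T j d is then an extra matching edge.
  side-seen-from-ℐ⇒ℐ-misses-corner : ∀ {j u w d} → I u ≡ true → I w ≡ true → u ≢ w →
    SeesOpposite w j d → a u (T j d) ≡ true → ⊥
  side-seen-from-ℐ⇒ℐ-misses-corner {j} {u} {w} {d} iu iw u≢w s uT =
    no-larger-matching T′ T′-disjoint (consEdge u (T j d) M)
    (consEdge-matching T′ M u (T j d) M-avoids-T′ uT (λ _ _ → ≢-sym (ℐ∉ℳ iu)) (λ _ _ → ℳ∉𝒯)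
      (avoids-replaceAt (≢tri u≢w (ℐ∉𝒯 iu) (ℐ∉𝒯 iu)) (avoids⇒avoidsExcept (ℐ-avoids-𝒯 iu))) corner-avoids-T′)
    where open VertexSwap j w iw d s

  -- Replace T j by the triangle l sees and T j′ by the triangle w sees; the side of T j opposite c and
  -- the corner d′ of T j′ then form a third triangle.
  seen-by-edge-and-ℐ⇒not-complete : ∀ {j j′ l c w d′} → j ≢ j′ → EdgeSees l (T j c) → I w ≡ true →
    SeesOpposite w j′ d′ → (∀ c₀ c₀′ → a (T j c₀) (T j′ c₀′) ≡ true) → ⊥
  seen-by-edge-and-ℐ⇒not-complete {j} {j′} {l} {c} {w} {d′} j≢j′ s iw s′ complete =
    proj₁ EM (◂-disjoint T″ _ T″-disjoint t△
      (tri-all {P = Avoids T″} (T-avoids (other₁≢ c)) (T-avoids (other₂≢ c)) T′-avoids))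
    where
    open EdgeSwap j l c s
    T″ = replaceAt j′ (tri w (T j′ (other₁ d′)) (T j′ (other₂ d′))) T′
    T″-disjoint : IsDisjTriangles a T″
    T″-disjoint = replaceAt-disjoint T′ j′ _ T′-disjoint (seesSide-triangle s′)
      (tri-all {P = AvoidsExcept T′ j′}
        (λ j₀ d₀ _ → avoids-replaceAt (≢tri (ℐ∉ℳ iw) (ℐ∉ℳ iw) (ℐ∉𝒯 iw)) (avoids⇒avoidsExcept (ℐ-avoids-𝒯 iw)) j₀ d₀)
        (T′-corner (other₁ d′)) (T′-corner (other₂ d′)))
      where
      T′-corner : ∀ d₀ → AvoidsExcept T′ j′ (T j′ d₀)
      T′-corner d₀ = avoidsExcept-replaceAt (≢tri (≢-sym ℳ∉𝒯) (≢-sym ℳ∉𝒯) (𝒯-distinct-triangles (≢-sym j≢j′)))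
                       (λ j₀ _ _ j₀≢j′ → 𝒯-distinct-triangles (≢-sym j₀≢j′))
    t△ : IsTriangle a (tri (T j (other₁ c)) (T j (other₂ c)) (T j′ d′))
    t△ = opposite-side j c , complete (other₂ c) d′ , complete (other₁ c) d′
    T-avoids : ∀ {d₀} → d₀ ≢ c → Avoids T″ (T j d₀)
    T-avoids d₀≢c = avoids-replaceAt (≢tri (≢-sym (ℐ∉𝒯 iw)) (𝒯-distinct-triangles j≢j′) (𝒯-distinct-triangles j≢j′))
      (avoidsExcept-replaceAt (≢tri (≢-sym ℳ∉𝒯) (≢-sym ℳ∉𝒯) (𝒯-distinct-corners d₀≢c))
        (λ _ _ j₀≢j _ → 𝒯-distinct-triangles (≢-sym j₀≢j)))
    T′-avoids : Avoids T″ (T j′ d′)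
    T′-avoids = avoids-replaceAt
      (≢tri (≢-sym (ℐ∉𝒯 iw)) (𝒯-distinct-corners (≢-sym (other₁≢ d′))) (𝒯-distinct-corners (≢-sym (other₂≢ d′))))
      (avoidsExcept-replaceAt (≢tri (≢-sym ℳ∉𝒯) (≢-sym ℳ∉𝒯) (𝒯-distinct-triangles (≢-sym j≢j′)))
        (λ _ _ _ j₀≢j′ → 𝒯-distinct-triangles (≢-sym j₀≢j′)))

  -- Replace T j and T j′ by the triangles w and w′ see; T j d T j′ d′ is then an extra matching edge.
  ℐ-seen-corners-nonadjacent : ∀ {j j′ w w′ d d′} → j ≢ j′ → I w ≡ true → I w′ ≡ true → w ≢ w′ →
    SeesOpposite w j d → SeesOpposite w′ j′ d′ → a (T j d) (T j′ d′) ≡ true → ⊥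
  ℐ-seen-corners-nonadjacent {j} {j′} {w} {w′} {d} {d′} j≢j′ iw iw′ w≢w′ s s′ TT =
    no-larger-matching T″ T″-disjoint (consEdge (T j d) (T j′ d′) M)
      (consEdge-matching T″ M _ _ M-avoids-T″ TT (λ _ _ → ℳ∉𝒯) (λ _ _ → ℳ∉𝒯) T-avoids T′-avoids)
    where
    open VertexSwap j w iw d s
    T″ = replaceAt j′ (tri w′ (T j′ (other₁ d′)) (T j′ (other₂ d′))) T′
    T″-disjoint : IsDisjTriangles a T″
    T″-disjoint = replaceAt-disjoint T′ j′ _ T′-disjoint (seesSide-triangle s′)
      (tri-all {P = AvoidsExcept T′ j′}
        (avoids⇒avoidsExcept (avoids-replaceAt (≢tri (≢-sym w≢w′) (ℐ∉𝒯 iw′) (ℐ∉𝒯 iw′))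
                                                (avoids⇒avoidsExcept (ℐ-avoids-𝒯 iw′))))
        (T′-corner (other₁ d′)) (T′-corner (other₂ d′)))
      where
      T′-corner : ∀ d₀ → AvoidsExcept T′ j′ (T j′ d₀)
      T′-corner d₀ = avoidsExcept-replaceAt
        (≢tri (≢-sym (ℐ∉𝒯 iw)) (𝒯-distinct-triangles (≢-sym j≢j′)) (𝒯-distinct-triangles (≢-sym j≢j′)))
        (λ j₀ _ _ j₀≢j′ → 𝒯-distinct-triangles (≢-sym j₀≢j′))
    M-avoids-T″ : IsMatchingAvoiding a T″ M
    M-avoids-T″ = replaceAt-matching T′ j′ _ M M-avoids-T′ (λ l c → ≢tri (≢-sym (ℐ∉ℳ iw′)) ℳ∉𝒯 ℳ∉𝒯)
    T-avoids : Avoids T″ (T j d)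
    T-avoids = avoids-replaceAt (≢tri (≢-sym (ℐ∉𝒯 iw′)) (𝒯-distinct-triangles j≢j′) (𝒯-distinct-triangles j≢j′))
      (avoidsExcept-replaceAt
        (≢tri (≢-sym (ℐ∉𝒯 iw)) (𝒯-distinct-corners (≢-sym (other₁≢ d))) (𝒯-distinct-corners (≢-sym (other₂≢ d))))
        (λ _ _ j₀≢j _ → 𝒯-distinct-triangles (≢-sym j₀≢j)))
    T′-avoids : Avoids T″ (T j′ d′)
    T′-avoids = avoids-replaceAt
      (≢tri (≢-sym (ℐ∉𝒯 iw′)) (𝒯-distinct-corners (≢-sym (other₁≢ d′))) (𝒯-distinct-corners (≢-sym (other₂≢ d′))))
      (avoidsExcept-replaceAt
        (≢tri (≢-sym (ℐ∉𝒯 iw)) (𝒯-distinct-triangles (≢-sym j≢j′)) (𝒯-distinct-triangles (≢-sym j≢j′)))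
        (λ _ _ _ j₀≢j′ → 𝒯-distinct-triangles (≢-sym j₀≢j′)))

  -- Replace T j and T j′ by the triangles l and l′ see; the side of T j opposite c and the corner d′
  -- of T j′ then form a third triangle.
  corner-seen⇒opposite-side-misses-unseen-corner : ∀ {j j′ l l′ c c′ d′} → j ≢ j′ → l ≢ l′ →
    EdgeSees l (T j c) → EdgeSees l′ (T j′ c′) → d′ ≢ c′ →
    a (T j (other₁ c)) (T j′ d′) ≡ true → a (T j (other₂ c)) (T j′ d′) ≡ true → ⊥
  corner-seen⇒opposite-side-misses-unseen-corner {j} {j′} {l} {l′} {c} {c′} {d′} j≢j′ l≢l′ s s′ d′≢c′ h₁ h₂ =
    proj₁ EM (◂-disjoint T″ _ T″-disjoint t△
      (tri-all {P = Avoids T″} (T-avoids (other₁≢ c)) (T-avoids (other₂≢ c)) T′-avoids))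
    where
    open EdgeSwap j l c s
    T″ = replaceAt j′ (tri (x l′) (y l′) (T j′ c′)) T′
    T″-disjoint : IsDisjTriangles a T″
    T″-disjoint = replaceAt-disjoint T′ j′ _ T′-disjoint (edgeSees-triangle s′)
      (tri-all {P = AvoidsExcept T′ j′} (l′-only e0) (l′-only e1)
        (avoidsExcept-replaceAt (≢tri (≢-sym ℳ∉𝒯) (≢-sym ℳ∉𝒯) (𝒯-distinct-triangles (≢-sym j≢j′)))
          (λ j₀ _ _ j₀≢j′ → 𝒯-distinct-triangles (≢-sym j₀≢j′))))
      where
      l′-only : ∀ c₀ → AvoidsExcept T′ j′ (M l′ c₀)
      l′-only c₀ = avoids⇒avoidsExcept (avoids-replaceAt
                     (≢tri (ℳ-distinct (≢-sym l≢l′)) (ℳ-distinct (≢-sym l≢l′)) ℳ∉𝒯)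
                     (avoids⇒avoidsExcept (ℳ-avoids-𝒯 l′ c₀)))
    t△ : IsTriangle a (tri (T j (other₁ c)) (T j (other₂ c)) (T j′ d′))
    t△ = opposite-side j c , h₂ , h₁
    T-avoids : ∀ {d₀} → d₀ ≢ c → Avoids T″ (T j d₀)
    T-avoids d₀≢c = avoids-replaceAt (≢tri (≢-sym ℳ∉𝒯) (≢-sym ℳ∉𝒯) (𝒯-distinct-triangles j≢j′))
      (avoidsExcept-replaceAt (≢tri (≢-sym ℳ∉𝒯) (≢-sym ℳ∉𝒯) (𝒯-distinct-corners d₀≢c))
        (λ _ _ j₀≢j _ → 𝒯-distinct-triangles (≢-sym j₀≢j)))
    T′-avoids : Avoids T″ (T j′ d′)
    T′-avoids = avoids-replaceAt (≢tri (≢-sym ℳ∉𝒯) (≢-sym ℳ∉𝒯) (𝒯-distinct-corners d′≢c′))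
      (avoidsExcept-replaceAt (≢tri (≢-sym ℳ∉𝒯) (≢-sym ℳ∉𝒯) (𝒯-distinct-triangles (≢-sym j≢j′)))
        (λ _ _ _ j₀≢j′ → 𝒯-distinct-triangles (≢-sym j₀≢j′)))

count₂≤1 : ∀ (f : Fin 2 → Bool) → f e0 ∧ f e1 ≡ false → countFin 2 f ≤ 1
count₂≤1 f none = ≤ᵇ⇒≤ _ _ (resolve none (table (f e0) (f e1)))
  where
  table : Valid 2 λ p q → (p ∧ q) ∨ (⟦ p ⟧ + (⟦ q ⟧ + 0) ≤ᵇ 1)
  table = tautology 2 _

count₃≤2 : ∀ (f : Fin 3 → Bool) → f f0 ∧ f f1 ∧ f f2 ≡ false → countFin 3 f ≤ 2
count₃≤2 f none = ≤ᵇ⇒≤ _ _ (resolve none (table (f f0) (f f1) (f f2)))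
  where
  table : Valid 3 λ p q r → (p ∧ q ∧ r) ∨ (⟦ p ⟧ + (⟦ q ⟧ + (⟦ r ⟧ + 0)) ≤ᵇ 2)
  table = tautology 3 _

count₃≤1 : ∀ (f : Fin 3 → Bool) → (∀ c c′ → c ≢ c′ → f c ∧ f c′ ≡ false) → countFin 3 f ≤ 1
count₃≤1 f none = ≤ᵇ⇒≤ _ _ (resolve (none f1 f2 λ ()) (resolve (none f0 f2 λ ()) (resolve (none f0 f1 λ ())
                    (table (f f0) (f f1) (f f2)))))
  where
  table : Valid 3 λ p q r → (p ∧ q) ∨ (p ∧ r) ∨ (q ∧ r) ∨ (⟦ p ⟧ + (⟦ q ⟧ + (⟦ r ⟧ + 0)) ≤ᵇ 1)
  table = tautology 3 _

⟦⟧+⟦⟧≤1 : ∀ p q → p ∧ q ≡ false → ⟦ p ⟧ + ⟦ q ⟧ ≤ 1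
⟦⟧+⟦⟧≤1 p q none = ≤ᵇ⇒≤ _ _ (resolve none (table p q))
  where
  table : Valid 2 λ p q → (p ∧ q) ∨ (⟦ p ⟧ + ⟦ q ⟧ ≤ᵇ 1)
  table = tautology 2 _

sum₃-around : ∀ (f : Fin 3 → ℕ) c → sumFin 3 f ≡ f c + (f (other₁ c) + f (other₂ c))
sum₃-around f zero             = cong (λ z → f f0 + (f f1 + z)) (+-identityʳ (f f2))
sum₃-around f (suc zero)       = ring (f f0) (f f1) (f f2)
  where ring : ∀ a b c → a + (b + (c + 0)) ≡ b + (a + c)
        ring = solve-∀
sum₃-around f (suc (suc zero)) = ring (f f0) (f f1) (f f2)
  where ring : ∀ a b c → a + (b + (c + 0)) ≡ c + (a + b)
        ring = solve-∀

all₃ : ∀ {f : Fin 3 → Bool} → f f0 ∧ f f1 ∧ f f2 ≡ true → ∀ c → f c ≡ true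
all₃ {f} all zero             = ∧-elimˡ all
all₃ {f} all (suc zero)       = ∧-elimˡ (∧-elimʳ {f f0} all)
all₃ {f} all (suc (suc zero)) = ∧-elimʳ {f f1} (∧-elimʳ {f f0} all)

count₃₃≤8 : ∀ (B : Fin 3 → Fin 3 → Bool) → ((∀ c c′ → B c c′ ≡ true) → ⊥) → sumFin 3 (λ c → countFin 3 (B c)) ≤ 8
count₃₃≤8 B incomplete =
  ≤ᵇ⇒≤ _ _ (resolve (¬-not λ all → incomplete λ c → all₃ {λ c′ → B c c′} (all₃ {λ c → row c} all c))
  (table (B f0 f0) (B f0 f1) (B f0 f2) (B f1 f0) (B f1 f1) (B f1 f2) (B f2 f0) (B f2 f1) (B f2 f2)))
  where
  row : Fin 3 → Bool
  row c = B c f0 ∧ B c f1 ∧ B c f2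
  table : Valid 9 λ a b c d e f g h i →
    ((a ∧ b ∧ c) ∧ (d ∧ e ∧ f) ∧ (g ∧ h ∧ i)) ∨
    ((⟦ a ⟧ + (⟦ b ⟧ + (⟦ c ⟧ + 0))) + ((⟦ d ⟧ + (⟦ e ⟧ + (⟦ f ⟧ + 0))) + ((⟦ g ⟧ + (⟦ h ⟧ + (⟦ i ⟧ + 0))) + 0)) ≤ᵇ 8)
  table = tautology 9 _

≤ᵇ-true⇒≤ : ∀ {m n} → (m ≤ᵇ n) ≡ true → m ≤ n
≤ᵇ-true⇒≤ {m} {n} e = ≤ᵇ⇒≤ m n (subst T (sym e) tt)

module Bounds {n k : ℕ} (G : Graph n) (EM : EdgeMaximal G k)
  (T : Fin k → Fin 3 → Fin n) (TD : IsDisjTriangles (adj G) T)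
  {m : ℕ} (M : Fin m → Fin 2 → Fin n) (MA : IsMatchingAvoiding (adj G) T M)
  (maxM : LeftoverMatchingsAtMost G k m) where

  open Extremal G EM T TD M MA maxM

  edge-seeing : ∀ j → 1 ≤ nEdgesSee j → ∃₂ λ l c → EdgeSees l (T j c)
  edge-seeing j pos with count-witness m _ pos
  ... | l , sees with anyFin-witness 3 _ sees
  ...   | c , s = l , c , s

  other-edge-seeing : ∀ j → 2 ≤ nEdgesSee j → ∀ l₀ → ∃₂ λ l c → l ≢ l₀ × EdgeSees l (T j c)
  other-edge-seeing j two l₀ with count≥2-witness≢ m _ two l₀
  ... | l , l≢l₀ , sees with anyFin-witness 3 _ sees
  ...   | c , s = l , c , l≢l₀ , s

  seesTri⇒seesOpposite : ∀ w j → vertexSeesTri a w (T j) ≡ true → ∃ λ d → SeesOpposite w j d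
  seesTri⇒seesOpposite w j sees with ∨-elim sees
  ... | inj₁ s₂ = f2 , s₂
  ... | inj₂ s with ∨-elim s
  ...   | inj₁ s₀ = f0 , s₀
  ...   | inj₂ s₁ = f1 , s₁

  ℐ-seeing : ∀ j → 1 ≤ nIsee j → ∃₂ λ w d → I w ≡ true × SeesOpposite w j d
  ℐ-seeing j pos with count-witness n _ pos
  ... | w , iw∧sees with seesTri⇒seesOpposite w j (∧-elimʳ {I w} iw∧sees)
  ...   | d , s = w , d , ∧-elimˡ iw∧sees , s

  other-ℐ-seeing : ∀ j → 2 ≤ nIsee j → ∀ u → ∃₂ λ w d → w ≢ u × I w ≡ true × SeesOpposite w j d
  other-ℐ-seeing j two u with count≥2-witness≢ n _ two u
  ... | w , w≢u , iw∧sees with seesTri⇒seesOpposite w j (∧-elimʳ {I w} iw∧sees)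
  ...   | d , s = w , d , w≢u , ∧-elimˡ iw∧sees , s

  𝒯₁-seen-twice : ∀ {j} → T₁ j ≡ true → 2 ≤ nEdgesSee j
  𝒯₁-seen-twice = ≤ᵇ-true⇒≤

  𝒯₁-edge-seeing : ∀ {j} → T₁ j ≡ true → ∃₂ λ l c → EdgeSees l (T j c)
  𝒯₁-edge-seeing {j} t₁ = edge-seeing j (≤-trans (s≤s z≤n) (𝒯₁-seen-twice t₁))

  𝒯₂-cases : ∀ {j} → T₂ j ≡ true → (1 ≤ nEdgesSee j × 1 ≤ nIsee j) ⊎ 2 ≤ nIsee j
  𝒯₂-cases {j} t₂ with ∨-elim (∧-elimʳ {not (T₁ j)} t₂)
  ... | inj₁ both = inj₁ (≤ᵇ-true⇒≤ (∧-elimˡ both) , ≤ᵇ-true⇒≤ (∧-elimʳ {1 ≤ᵇ nEdgesSee j} both))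
  ... | inj₂ two  = inj₂ (≤ᵇ-true⇒≤ two)

  𝒯₂-ℐ-seeing : ∀ {j} → T₂ j ≡ true → ∃₂ λ w d → I w ≡ true × SeesOpposite w j d
  𝒯₂-ℐ-seeing {j} t₂ with 𝒯₂-cases t₂
  ... | inj₁ (_ , pos) = ℐ-seeing j pos
  ... | inj₂ two       = ℐ-seeing j (≤-trans (s≤s z≤n) two)

  vertex-meets-ℳ-edge-once : ∀ u l → Avoids T u → countFin 2 (λ c → a u (M l c)) ≤ 1
  vertex-meets-ℳ-edge-once u l u∉T = count₂≤1 (λ c → a u (M l c)) (¬-not λ both →
    no-triangle-avoiding-𝒯 (tri u (x l) (y l)) (∧-elimˡ both , ℳ-edge l , ∧-elimʳ both)
      (tri-all {P = Avoids T} u∉T (ℳ-avoids-𝒯 l e0) (ℳ-avoids-𝒯 l e1)))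

  -- An edge of ℳ is joined to T j by at most 3 edges plus one for each corner it sees.
  ℳ-edge-to-𝒯₁≤4 : ∀ l j → T₁ j ≡ true → blockArcs a (M l) (T j) ≤ 4
  ℳ-edge-to-𝒯₁≤4 l j t₁ = begin
    blockArcs a (M l) (T j)
      ≡⟨ sum-swap 2 3 (λ c c′ → ⟦ a (M l c) (T j c′) ⟧) ⟩
    sumFin 3 (λ c′ → countFin 2 (λ c → a (M l c) (T j c′)))
      ≤⟨ sum-mono 3 (λ c′ → ends (T j c′)) ⟩
    sumFin 3 (λ c′ → 1 + ⟦ seen c′ ⟧)
      ≡⟨ sum-+ 3 (λ _ → 1) (λ c′ → ⟦ seen c′ ⟧) ⟩
    3 + countFin 3 seen
      ≤⟨ +-monoʳ-≤ 3 (count₃≤1 seen seen-once) ⟩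
    4 ∎
    where
    open ≤-Reasoning
    seen : Fin 3 → Bool
    seen c = edgeSeesVertex a (x l) (y l) (T j c)
    ends : ∀ v → countFin 2 (λ c → a (M l c) v) ≤ 1 + ⟦ edgeSeesVertex a (x l) (y l) v ⟧
    ends v = ≤ᵇ⇒≤ _ _ (resolve (cong not (ℳ-edge l)) (table (a (x l) (y l)) (a (x l) v) (a (y l) v)))
      where
      table : Valid 3 λ e p q → not e ∨ (⟦ p ⟧ + (⟦ q ⟧ + 0) ≤ᵇ 1 + ⟦ e ∧ p ∧ q ⟧)
      table = tautology 3 _
    seen-once : ∀ c c′ → c ≢ c′ → seen c ∧ seen c′ ≡ false
    seen-once c c′ c≢c′ = ¬-not λ both → c≢c′ (same-corner (∧-elimˡ both) (∧-elimʳ {seen c} both))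
      where
      same-corner : EdgeSees l (T j c) → EdgeSees l (T j c′) → c ≡ c′
      same-corner s s′ with other-edge-seeing j (𝒯₁-seen-twice t₁) l
      ... | l″ , c″ , l″≢l , s″ = trans (sym (edges-see-same-corner l″≢l s″ s)) (edges-see-same-corner l″≢l s″ s′)

  ℐ-to-𝒯₁≤2 : ∀ u j → I u ≡ true → T₁ j ≡ true → countFin 3 (λ c → a u (T j c)) ≤ 2
  ℐ-to-𝒯₁≤2 u j iu t₁ with 𝒯₁-edge-seeing t₁
  ... | l , c , s = count₃≤2 (λ c → a u (T j c)) (¬-not λ all →
    corner-seen⇒ℐ-misses-opposite-side s iu (all₃ {λ c → a u (T j c)} all (other₁ c))
                                            (all₃ {λ c → a u (T j c)} all (other₂ c)))

  ℐ-to-𝒯₂≤2 : ∀ u j → I u ≡ true → T₂ j ≡ true → countFin 3 (λ c → a u (T j c)) ≤ 2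
  ℐ-to-𝒯₂≤2 u j iu t₂ = count₃≤2 (λ c → a u (T j c)) (¬-not λ all → not-all (all₃ {λ c → a u (T j c)} all))
    where
    not-all : (∀ c → a u (T j c) ≡ true) → ⊥
    not-all all with 𝒯₂-cases t₂
    ... | inj₁ (pos , _) with edge-seeing j pos
    ...   | l , c , s = corner-seen⇒ℐ-misses-opposite-side s iu (all (other₁ c)) (all (other₂ c))
    not-all all | inj₂ two with other-ℐ-seeing j two u
    ...   | w , d , w≢u , iw , s = side-seen-from-ℐ⇒ℐ-misses-corner iu iw (≢-sym w≢u) s (all d)

  -- Only the corner of T j′ seen by an edge of ℳ can be joined to all three corners of T j.
  𝒯₁-to-𝒯₁≤7 : ∀ j j′ → T₁ j ≡ true → T₁ j′ ≡ true → j′ ≢ j → blockArcs a (T j) (T j′) ≤ 7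
  𝒯₁-to-𝒯₁≤7 j j′ t₁ t₁′ j′≢j with 𝒯₁-edge-seeing t₁
  ... | l , c , s with other-edge-seeing j′ (𝒯₁-seen-twice t₁′) l
  ...   | l′ , c′ , l′≢l , s′ = begin
    blockArcs a (T j) (T j′)
      ≡⟨ sum-swap 3 3 (λ c₀ d′ → ⟦ a (T j c₀) (T j′ d′) ⟧) ⟩
    sumFin 3 column
      ≡⟨ sum₃-around column c′ ⟩
    column c′ + (column (other₁ c′) + column (other₂ c′))
      ≤⟨ +-mono-≤ (sum-mono 3 (λ c₀ → mask≤ (a (T j c₀) (T j′ c′)) 1))
                  (+-mono-≤ (unseen (other₁ c′) (other₁≢ c′)) (unseen (other₂ c′) (other₂≢ c′))) ⟩
    7 ∎
    where
    open ≤-Reasoning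
    column : Fin 3 → ℕ
    column d′ = countFin 3 (λ c₀ → a (T j c₀) (T j′ d′))
    unseen : ∀ d′ → d′ ≢ c′ → column d′ ≤ 2
    unseen d′ d′≢c′ = begin
      column d′
        ≡⟨ sum₃-around (λ c₀ → ⟦ a (T j c₀) (T j′ d′) ⟧) c ⟩
      ⟦ a (T j c) (T j′ d′) ⟧ + (⟦ a (T j (other₁ c)) (T j′ d′) ⟧ + ⟦ a (T j (other₂ c)) (T j′ d′) ⟧)
        ≤⟨ +-mono-≤ (mask≤ (a (T j c) (T j′ d′)) 1)
                    (⟦⟧+⟦⟧≤1 (a (T j (other₁ c)) (T j′ d′)) (a (T j (other₂ c)) (T j′ d′)) (¬-not λ both →
             corner-seen⇒opposite-side-misses-unseen-corner (≢-sym j′≢j) (≢-sym l′≢l) s s′ d′≢c′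
               (∧-elimˡ both) (∧-elimʳ {a (T j (other₁ c)) (T j′ d′)} both))) ⟩
      2 ∎

  𝒯₂-to-𝒯₂≤8 : ∀ j j′ → T₂ j ≡ true → T₂ j′ ≡ true → j′ ≢ j → blockArcs a (T j) (T j′) ≤ 8
  𝒯₂-to-𝒯₂≤8 j j′ t₂ t₂′ j′≢j = count₃₃≤8 (λ c c′ → a (T j c) (T j′ c′)) (not-complete (≢-sym j′≢j) t₂ t₂′)
    where
    not-complete : ∀ {j j′} → j ≢ j′ → T₂ j ≡ true → T₂ j′ ≡ true → (∀ c c′ → a (T j c) (T j′ c′) ≡ true) → ⊥
    not-complete {j} {j′} j≢j′ t₂ t₂′ complete with 𝒯₂-cases t₂
    ... | inj₁ (pos , _) with edge-seeing j pos | 𝒯₂-ℐ-seeing t₂′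
    ...   | l , c , s | w′ , d′ , iw′ , s′ = seen-by-edge-and-ℐ⇒not-complete j≢j′ s iw′ s′ complete
    not-complete {j} {j′} j≢j′ t₂ t₂′ complete | inj₂ two with ℐ-seeing j (≤-trans (s≤s z≤n) two) | 𝒯₂-cases t₂′
    ... | w , d , iw , s | inj₁ (pos′ , _) with edge-seeing j′ pos′
    ...   | l′ , c′ , s′ = seen-by-edge-and-ℐ⇒not-complete (≢-sym j≢j′) s′ iw s (λ c₀ c₀′ → adj-sym (complete c₀′ c₀))
    not-complete {j} {j′} j≢j′ t₂ t₂′ complete | inj₂ two | w , d , iw , s | inj₂ two′ with other-ℐ-seeing j′ two′ w
    ...   | w′ , d′ , w′≢w , iw′ , s′ = ℐ-seen-corners-nonadjacent j≢j′ iw iw′ (≢-sym w′≢w) s s′ (complete d d′)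

  eIn-ℐ : eIn a I ≡ 0
  eIn-ℐ = trans (sum-cong n (λ u → trans (sum-cong n (no-edge u)) (sum-zero n))) (sum-zero n)
    where
    no-edge : ∀ u v → ⟦ u ≺ v ∧ I u ∧ I v ∧ a u v ⟧ ≡ 0
    no-edge u v with u ≺ v ∧ I u ∧ I v ∧ a u v in e
    ... | false = refl
    ... | true  = ⊥-elim (ℐ-independent (∧-elimˡ e′) (∧-elimˡ (∧-elimʳ {I u} e′)) (∧-elimʳ {I v} (∧-elimʳ {I u} e′)))
      where e′ = ∧-elimʳ {u ≺ v} e

  eBetween-ℐ-ℳ : eBetween a I (matchV M) ≤ countFin n I * m
  eBetween-ℐ-ℳ = subst (eBetween a I (matchV M) ≤_)
                       (cong (countFin n I *_) (trans (cong (_* 1) (count-all m)) (*-identityʳ m)))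
    (eBetween-vertices-coveredBy≤ G I M (λ _ → true) 1 (λ u l iu _ → vertex-meets-ℳ-edge-once u l (ℐ-avoids-𝒯 iu)))

  eIn-ℳ : eIn a (matchV M) ≤ m * m
  eIn-ℳ = double≤⇒≤square m _ (subst (λ t → eIn a (matchV M) + eIn a (matchV M) ≤ t * (2 + 2 * (t ∸ 1))) (count-all m)
    (eIn-coveredBy≤ G M (λ _ → true) 2 2 (λ l _ → blockArcs-self≤ G (M l))
      (λ l l′ _ _ _ → blockArcs-rows≤ G (M l) (M l′) 1 (λ c → vertex-meets-ℳ-edge-once (M l c) l′ (ℳ-avoids-𝒯 l c)))))

  eBetween-ℳ-𝒯₁ : eBetween a (matchV M) (trisV T T₁) ≤ 4 * m * countFin k T₁
  eBetween-ℳ-𝒯₁ = subst (eBetween a (matchV M) (trisV T T₁) ≤_)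
                        (trans (cong (_* (countFin k T₁ * 4)) (count-all m)) (ring m (countFin k T₁)))
    (eBetween-coveredBy≤ G M (λ _ → true) T T₁ 4 (λ l j _ t₁ → ℳ-edge-to-𝒯₁≤4 l j t₁))
    where ring : ∀ m t → m * (t * 4) ≡ 4 * m * t
          ring = solve-∀

  i*[t*2]≡2*i*t : ∀ i t → i * (t * 2) ≡ 2 * i * t
  i*[t*2]≡2*i*t = solve-∀

  eBetween-ℐ-𝒯₁ : eBetween a I (trisV T T₁) ≤ 2 * countFin n I * countFin k T₁
  eBetween-ℐ-𝒯₁ = subst (eBetween a I (trisV T T₁) ≤_) (i*[t*2]≡2*i*t (countFin n I) (countFin k T₁))
                        (eBetween-vertices-coveredBy≤ G I T T₁ 2 ℐ-to-𝒯₁≤2)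

  eBetween-ℐ-𝒯₂ : eBetween a I (trisV T T₂) ≤ 2 * countFin n I * countFin k T₂
  eBetween-ℐ-𝒯₂ = subst (eBetween a I (trisV T T₂) ≤_) (i*[t*2]≡2*i*t (countFin n I) (countFin k T₂))
                        (eBetween-vertices-coveredBy≤ G I T T₂ 2 ℐ-to-𝒯₂≤2)

  eIn-𝒯₁ : eIn a (trisV T T₁) ≤ 7 * (countFin k T₁ C 2) + 3 * countFin k T₁
  eIn-𝒯₁ = double≤⇒≤binomial 7 (countFin k T₁) _
             (eIn-coveredBy≤ G T T₁ 6 7 (λ j _ → blockArcs-self≤ G (T j)) 𝒯₁-to-𝒯₁≤7)

  eIn-𝒯₂ : eIn a (trisV T T₂) ≤ 8 * (countFin k T₂ C 2) + 3 * countFin k T₂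
  eIn-𝒯₂ = double≤⇒≤binomial 8 (countFin k T₂) _
             (eIn-coveredBy≤ G T T₂ 6 8 (λ j _ → blockArcs-self≤ G (T j)) 𝒯₂-to-𝒯₂≤8)

peel-arithmetic : ∀ E′ E₁ E₀ s S′ X d e → E′ + 3 * suc s + X ≤ E₁ + S′ + 8 * e → E₁ ≤ E₀ + 3 + 8 * d →
  E′ + 3 * s + X ≤ E₀ + S′ + 8 * (d + e)
peel-arithmetic E′ E₁ E₀ s S′ X d e ih step =
  +-cancelʳ-≤ 3 _ _ (subst₂ _≤_ (lhs E′ s X) (rhs E₀ d S′ e) (≤-trans ih (+-monoˡ-≤ (8 * e) (+-monoˡ-≤ S′ step))))
  where
  lhs : ∀ E s X → E + 3 * suc s + X ≡ E + 3 * s + X + 3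
  lhs = solve-∀
  rhs : ∀ E d S e → E + 3 + 8 * d + S + 8 * e ≡ E + S + 8 * (d + e) + 3
  rhs = solve-∀

peel-final-arithmetic : ∀ {E z e d} s t → z ≡ 0 → e ≡ 0 → d + z ≡ t + s →
  E + 3 * z + 8 * (t C 2) ≤ e + 3 * s + 8 * (d C 2) → E ≤ 8 * (s C 2) + 8 * s * t + 3 * s
peel-final-arithmetic {E} {d = d} s t refl refl d+0≡t+s h =
  +-cancelʳ-≤ (8 * (t C 2)) E _ (subst₂ _≤_ (lhs E (8 * (t C 2))) rhs
    (subst (λ d → E + 0 + 8 * (t C 2) ≤ 0 + 3 * s + 8 * (d C 2)) (trans (sym (+-identityʳ d)) d+0≡t+s) h))
  where
  lhs : ∀ E x → E + 0 + x ≡ E + x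
  lhs = solve-∀
  rhs : 0 + 3 * s + 8 * ((t + s) C 2) ≡ 8 * (s C 2) + 8 * s * t + 3 * s + 8 * (t C 2)
  rhs = trans (cong (λ c → 3 * s + 8 * c) (C2-+ t s)) (ring s t (s C 2) (t C 2))
    where
    ring : ∀ s t c d → 3 * s + 8 * (d + c + t * s) ≡ 8 * c + 8 * s * t + 3 * s + 8 * d
    ring = solve-∀

module Peeling {n k m : ℕ} (G : Graph n) (T : Fin k → Fin 3 → Fin n) (TD : IsDisjTriangles (adj G) T)
  (M : Fin m → Fin 2 → Fin n) where

  open Setting G T M

  private
    a = adj G
    ∣_∣ : (Fin k → Bool) → ℕ
    ∣ P ∣ = countFin k P

  edgesTouching : (Fin k → Bool) → (Fin k → Bool) → ℕ
  edgesTouching S D = eIn a (trisV T S) + eBetween a (trisV T S) (trisV T D)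

  only : Fin k → Fin k → Bool
  only j j′ = ⌊ j′ ≟ j ⌋

  trisV-disjoint : ∀ {P R} → Disjoint P R → Disjoint (trisV T P) (trisV T R)
  trisV-disjoint {P} {R} P∩R v with trisV T P v ∧ trisV T R v in both
  ... | false = refl
  ... | true with anyFin-witness k _ (∧-elimˡ both) | anyFin-witness k _ (∧-elimʳ {trisV T P v} both)
  ...   | j , pj | j′ , rj′ with anyFin-witness 3 _ (∧-elimʳ {P j} pj) | anyFin-witness 3 _ (∧-elimʳ {R j′} rj′)
  ...     | c , e | c′ , e′ with proj₁ (proj₁ TD j j′ c c′ (trans (≟-≡ e) (sym (≟-≡ e′))))
  ...       | refl = contradiction (trans (sym (∧-intro {P j} {R j} (∧-elimˡ pj) (∧-elimˡ rj′))) (P∩R j)) λ ()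

  trisV-∨ : ∀ P R v → trisV T (λ j → P j ∨ R j) v ≡ trisV T P v ∨ trisV T R v
  trisV-∨ P R v = anyFin-∨ k P R (λ j → anyFin 3 (λ c → ⌊ T j c ≟ v ⌋))

  eIn-triangle≤3 : ∀ j → eIn a (trisV T (only j)) ≤ 3
  eIn-triangle≤3 j = m+m≤n+n⇒m≤n
    (subst (λ t → eIn a (trisV T (only j)) + eIn a (trisV T (only j)) ≤ t * (6 + 0 * (t ∸ 1))) count-only
    (eIn-coveredBy≤ G T (only j) 6 0 (λ j₁ _ → blockArcs-self≤ G (T j₁))
      (λ j₁ j₂ e₁ e₂ j₂≢j₁ → contradiction (trans (≟-≡ e₂) (sym (≟-≡ e₁))) j₂≢j₁)))
    where
    count-only : ∣ only j ∣ ≡ 1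
    count-only = trans (count-extract k (only j) j (≟-refl j)) (cong suc (trans (sum-cong k others) (sum-zero k)))
      where
      others : ∀ i → mask (not ⌊ i ≟ j ⌋) ⟦ ⌊ i ≟ j ⌋ ⟧ ≡ 0
      others i with ⌊ i ≟ j ⌋
      ... | true  = refl
      ... | false = refl

  edgesTouching-move : ∀ D S j → D j ≡ true → Disjoint D S →
    edgesTouching (insert S j) (remove D j) ≤ edgesTouching S D + 3 + sends D j
  edgesTouching-move D S j dj D∩S = begin
    eIn a S′ + eBetween a S′ R
      ≤⟨ +-mono-≤ (eIn-∪≤ a S′ X J (trisV-∨ S (only j))) (eBetween-∪ˡ≤ a S′ X J R (trisV-∨ S (only j))) ⟩
    (eIn a X + eIn a J + eBetween a X J) + (eBetween a X R + eBetween a J R)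
      ≡⟨ regroup (eIn a X) (eIn a J) (eBetween a X J) (eBetween a X R) (eBetween a J R) ⟩
    eIn a X + (eBetween a X R + eBetween a X J) + eIn a J + eBetween a J R
      ≤⟨ +-monoˡ-≤ (eBetween a J R)
           (+-mono-≤ (+-monoʳ-≤ (eIn a X) (eBetween-∪ʳ≥ a X J R Y Y≗R∪J X∩J X∩R R∩J)) (eIn-triangle≤3 j)) ⟩
    eIn a X + eBetween a X Y + 3 + sends D j
      ∎
    where
    open ≤-Reasoning
    X = trisV T S
    Y = trisV T D
    J = trisV T (only j)
    R = trisV T (remove D j)
    S′ = trisV T (insert S j)
    regroup : ∀ x j xj xr jr → (x + j + xj) + (xr + jr) ≡ x + (xr + xj) + j + jr
    regroup = solve-∀
    S∌j : S j ≡ false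
    S∌j with S j in sj
    ... | false = refl
    ... | true  = contradiction (trans (sym (∧-intro {D j} {S j} dj sj)) (D∩S j)) λ ()
    Y≗R∪J : ∀ v → Y v ≡ R v ∨ J v
    Y≗R∪J v = trans (anyFin-cong k (λ j′ → cong (_∧ anyFin 3 (λ c → ⌊ T j′ c ≟ v ⌋)) (split j′)))
                    (trisV-∨ (remove D j) (only j) v)
      where
      split : ∀ j′ → D j′ ≡ remove D j j′ ∨ only j j′
      split j′ with j′ ≟ j
      ... | yes refl = trans dj (sym (∨-zeroʳ (D j ∧ false)))
      ... | no  _    = sym (trans (∨-identityʳ (D j′ ∧ true)) (∧-identityʳ (D j′)))
    X∩J : Disjoint X J
    X∩J = trisV-disjoint S∩j
      where
      S∩j : Disjoint S (only j)
      S∩j j′ with j′ ≟ j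
      ... | yes refl = trans (∧-identityʳ (S j)) S∌j
      ... | no  _    = ∧-zeroʳ (S j′)
    X∩R : Disjoint X R
    X∩R = trisV-disjoint λ j′ → S∩remove (D j′) (S j′) _ (D∩S j′)
      where
      S∩remove : ∀ d s b → d ∧ s ≡ false → s ∧ (d ∧ b) ≡ false
      S∩remove false s     b _ = ∧-zeroʳ s
      S∩remove true  false b _ = refl
    R∩J : Disjoint R J
    R∩J = trisV-disjoint λ j′ → removed (D j′) ⌊ j′ ≟ j ⌋
      where
      removed : ∀ d b → (d ∧ not b) ∧ b ≡ false
      removed false b     = refl
      removed true  true  = refl
      removed true  false = refl

  count-remove : ∀ D j → D j ≡ true → ∣ D ∣ ≡ suc ∣ remove D j ∣
  count-remove D j dj = trans (count-extract k D j dj) (cong suc (sum-cong k (λ i → masked (⌊ i ≟ j ⌋) (D i))))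
    where
    masked : ∀ b d → mask (not b) ⟦ d ⟧ ≡ ⟦ d ∧ not b ⟧
    masked true  d     = sym (cong ⟦_⟧ (∧-zeroʳ d))
    masked false d     = cong ⟦_⟧ (sym (∧-identityʳ d))

  count-insert : ∀ S j → S j ≡ false → ∣ insert S j ∣ ≡ suc ∣ S ∣
  count-insert S j sj = begin
    ∣ insert S j ∣
      ≡⟨ count-extract k (insert S j) j (trans (cong (_∨ _) sj) (≟-refl j)) ⟩
    suc (sumFin k (λ i → mask (not ⌊ i ≟ j ⌋) ⟦ S i ∨ ⌊ i ≟ j ⌋ ⟧))
      ≡⟨ cong suc (sum-cong k (λ i → masked ⌊ i ≟ j ⌋ (S i))) ⟩
    suc others
      ≡⟨ cong suc (trans (sum-extract k (λ i → ⟦ S i ⟧) j) (cong (λ b → ⟦ b ⟧ + others) sj)) ⟨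
    suc ∣ S ∣
      ∎
    where
    open ≡-Reasoning
    others = sumFin k (λ i → mask (not ⌊ i ≟ j ⌋) ⟦ S i ⟧)
    masked : ∀ b s → mask (not b) ⟦ s ∨ b ⟧ ≡ mask (not b) ⟦ s ⟧
    masked true  s = refl
    masked false s = cong ⟦_⟧ (∨-identityʳ s)

  -- Both sides are moved so that no truncated subtraction occurs.
  peel-invariant : ∀ {D S D′ S′} → Peel D S D′ S′ → Disjoint D S →
    (edgesTouching S′ D′ + 3 * ∣ S ∣ + 8 * (∣ D′ ∣ C 2) ≤ edgesTouching S D + 3 * ∣ S′ ∣ + 8 * (∣ D ∣ C 2))
    × (∣ D ∣ + ∣ S ∣ ≡ ∣ D′ ∣ + ∣ S′ ∣)
  peel-invariant (stop _) _ = ≤-refl , refl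
  peel-invariant {D} {S} {D′} {S′} (move j dj sends≤ rest) D∩S with peel-invariant rest D∖j∩S∪j
    where
    D∖j∩S∪j : Disjoint (remove D j) (insert S j)
    D∖j∩S∪j j′ with j′ ≟ j | D j′ | S j′ | D∩S j′
    ... | yes refl | false | _     | _  = refl
    ... | yes refl | true  | _     | _  = refl
    ... | no  _    | false | _     | _  = refl
    ... | no  _    | true  | false | _  = refl
    ... | no  _    | true  | true  | ()
  ... | ih , sizes = bound , sizes′
    where
    S∌j : S j ≡ false
    S∌j with S j in sj
    ... | false = refl
    ... | true  = contradiction (trans (sym (∧-intro {D j} {S j} dj sj)) (D∩S j)) λ ()
    d₁ = ∣ remove D j ∣
    ∣D∣ = count-remove D j dj
    E′ E₁ E₀ : ℕ
    E′ = edgesTouching S′ D′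
    E₁ = edgesTouching (insert S j) (remove D j)
    E₀ = edgesTouching S D
    bound : E′ + 3 * ∣ S ∣ + 8 * (∣ D′ ∣ C 2) ≤ E₀ + 3 * ∣ S′ ∣ + 8 * (∣ D ∣ C 2)
    bound = subst (λ t → E′ + 3 * ∣ S ∣ + 8 * (∣ D′ ∣ C 2) ≤ E₀ + 3 * ∣ S′ ∣ + 8 * t)
                  (trans (sym (suc-C2 d₁)) (cong (_C 2) (sym ∣D∣)))
      (peel-arithmetic E′ E₁ E₀ ∣ S ∣ (3 * ∣ S′ ∣) (8 * (∣ D′ ∣ C 2)) d₁ (d₁ C 2)
        (subst (λ s → E′ + 3 * s + 8 * (∣ D′ ∣ C 2) ≤ E₁ + 3 * ∣ S′ ∣ + 8 * (d₁ C 2)) (count-insert S j S∌j) ih)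
        (≤-trans (edgesTouching-move D S j dj D∩S)
                 (+-monoʳ-≤ (E₀ + 3) (subst (λ t → sends D j ≤ 8 * (t ∸ 1)) ∣D∣ sends≤))))
    sizes′ : ∣ D ∣ + ∣ S ∣ ≡ ∣ D′ ∣ + ∣ S′ ∣
    sizes′ = begin
      ∣ D ∣ + ∣ S ∣          ≡⟨ cong (_+ ∣ S ∣) ∣D∣ ⟩
      suc d₁ + ∣ S ∣         ≡⟨ +-suc d₁ ∣ S ∣ ⟨
      d₁ + suc ∣ S ∣         ≡⟨ cong (d₁ +_) (count-insert S j S∌j) ⟨
      d₁ + ∣ insert S j ∣    ≡⟨ sizes ⟩
      ∣ D′ ∣ + ∣ S′ ∣        ∎
      where open ≡-Reasoning

  peel-bound : ∀ {T₃ T₄} → Peel D₀ (λ _ → false) T₄ T₃ →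
    eIn a (trisV T T₃) + eBetween a (trisV T T₃) (trisV T T₄) ≤ 8 * (∣ T₃ ∣ C 2) + 8 * ∣ T₃ ∣ * ∣ T₄ ∣ + 3 * ∣ T₃ ∣
  peel-bound {T₃} {T₄} peel with peel-invariant peel (λ j → ∧-zeroʳ (D₀ j))
  ... | bound , sizes = peel-final-arithmetic ∣ T₃ ∣ ∣ T₄ ∣ (sum-zero k) nothing-touched sizes bound
    where
    ∅ : Fin k → Bool
    ∅ _ = false
    ∅-uncovered : ∀ v → trisV T ∅ v ≡ false
    ∅-uncovered v = anyFin-const-false k
    nothing-touched : edgesTouching ∅ D₀ ≡ 0
    nothing-touched = cong₂ _+_ (eIn-empty a (trisV T ∅) ∅-uncovered)
                                (eBetween-emptyˡ a (trisV T ∅) (trisV T D₀) ∅-uncovered)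

lemma4p2 : (n k : ℕ) (G : Graph n) → EdgeMaximal G k →
  (T : Fin k → Fin 3 → Fin n) → IsDisjTriangles (adj G) T →
  (m : ℕ) (M : Fin m → Fin 2 → Fin n) → IsMatchingAvoiding (adj G) T M →
  (∀ (T′ : Fin k → Fin 3 → Fin n) → IsDisjTriangles (adj G) T′ →
    ∀ (m′ : ℕ) (M′ : Fin m′ → Fin 2 → Fin n) → IsMatchingAvoiding (adj G) T′ M′ → m′ ≤ m) →
  (T₃ T₄ : Fin k → Bool) → Setting.Peel G T M (Setting.D₀ G T M) (λ _ → false) T₄ T₃ →
  let a = adj G
      I = Setting.Iset G T M
      MV = matchV M
      T1V = trisV T (Setting.T₁ G T M)
      T2V = trisV T (Setting.T₂ G T M)
      T3V = trisV T T₃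
      T4V = trisV T T₄
      i = countFin n I
      t₁ = countFin k (Setting.T₁ G T M)
      t₂ = countFin k (Setting.T₂ G T M)
      t₃ = countFin k T₃
      t₄ = countFin k T₄
  in (eIn a I ≡ 0)
     × (eBetween a I MV ≤ i * m)
     × (eIn a MV ≤ m * m)
     × (eBetween a MV T1V ≤ 4 * m * t₁)
     × (eBetween a I T1V ≤ 2 * i * t₁)
     × (eIn a T1V ≤ 7 * (t₁ C 2) + 3 * t₁)
     × (eBetween a I T2V ≤ 2 * i * t₂)
     × (eIn a T2V ≤ 8 * (t₂ C 2) + 3 * t₂)
     × (eIn a T3V + eBetween a T3V T4V ≤ 8 * (t₃ C 2) + 8 * t₃ * t₄ + 3 * t₃)
lemma4p2 n k G EM T TD m M MA maxM T₃ T₄ peel =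
  eIn-ℐ , eBetween-ℐ-ℳ , eIn-ℳ , eBetween-ℳ-𝒯₁ , eBetween-ℐ-𝒯₁ , eIn-𝒯₁ , eBetween-ℐ-𝒯₂ , eIn-𝒯₂ , peel-bound peel
  where
  open Bounds G EM T TD M MA maxM
  open Peeling G T TD M
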